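{- For $n\ge1$, $$F_n(x)=\sum_{k=1}^n\gamma_{n,k}x^k(1+x)^{2n-2k},$$ where the integers $\gamma_{n,k}$ are determined by $\gamma_{1,1}=1$, $\gamma_{1,k}=0$ for $k\ne1$, and $$\gamma_{n+1,k}=k\gamma_{n,k}+(2n-4k+5)\gamma_{n,k-1}.$$ In particular, $\gamma_{n+1,n+1}=(-1)^n(2n-1)!!$ for $n\ge1$.
   Context: A Stirling permutation of order $n$ is a permutation $\sigma$ of the multiset $\{1,1,2,2,\dots,n,n\}$ such that for each $i$ all entries between the two occurrences of $i$ are larger than $i$; $\mathcal{Q}_n$ is their set. $\Phi$ maps $\sigma\in\mathcal{Q}_n$ to the permutation of $[2n]$ obtained by replacing the first occurrence of each $j$ by $2j$ and the second by $2j-1$ (e.g. $\Phi(221331)=432651$); $\Phi(\mathcal{Q}_n)$ is the set of dual Stirling permutations. ${\rm altrun}(\pi)$ is the number of alternating runs (maximal consecutive increasing or decreasing subsequences) of $\pi$. $F_n(x)=\sum_{\pi\in\Phi(\mathcal{Q}_n)}x^{{\rm altrun}(\pi)}$. -}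

module Defs where

open import Data.Bool using (Bool; true; false; _∧_; _∨_; if_then_else_; not)
open import Data.Nat as ℕ using (ℕ; zero; suc; _∸_; _≡ᵇ_; _<ᵇ_)
open import Data.Integer as ℤ using (ℤ; +_; -_; _+_; _*_; _-_)
open import Data.List using (List; []; _∷_; length; filter; map; concatMap; upTo)
open import Data.Bool.ListAction using (all; any)
open import Relation.Binary.PropositionalEquality using (_≡_)
open import Relation.Nullary.Decidable using (does)
open import Data.Bool.Properties using (T?)
open import Data.Bool using (T)

words : ℕ → ℕ → List (List ℕ)
words n zero    = [] ∷ []
words n (suc m) = concatMap (λ a → map (a ∷_) (words n m)) (map suc (upTo n))

count : ℕ → List ℕ → ℕ
count a []       = zero
count a (b ∷ w)  = if a ≡ᵇ b then suc (count a w) else count a w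

elem : ℕ → List ℕ → Bool
elem a w = any (λ b → a ≡ᵇ b) w

beforeLarger : ℕ → List ℕ → Bool
beforeLarger a []      = true
beforeLarger a (b ∷ w) = if a ≡ᵇ b then true else ((a <ᵇ b) ∧ beforeLarger a w)

-- for each letter i, all entries between two occurrences of i are larger than i
betweenLarger : List ℕ → Bool
betweenLarger []      = true
betweenLarger (a ∷ w) = (if elem a w then beforeLarger a w else true) ∧ betweenLarger w

isMultisetPerm : ℕ → List ℕ → Bool
isMultisetPerm n w = (length w ≡ᵇ 2 ℕ.* n) ∧ all (λ i → count i w ≡ᵇ 2) (map suc (upTo n))
                     ∧ all (λ a → (1 ℕ.≤ᵇ a) ∧ (a ℕ.≤ᵇ n)) w

isStirling : ℕ → List ℕ → Bool
isStirling n w = isMultisetPerm n w ∧ betweenLarger w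

Q : ℕ → List (List ℕ)
Q n = filter (λ w → T? (isStirling n w)) (words n (2 ℕ.* n))

Φgo : List ℕ → List ℕ → List ℕ
Φgo seen []      = []
Φgo seen (a ∷ w) = (if elem a seen then 2 ℕ.* a ∸ 1 else 2 ℕ.* a) ∷ Φgo (a ∷ seen) w

Φ : List ℕ → List ℕ
Φ w = Φgo [] w

-- A maximal increasing/decreasing run of consecutive
-- entries corresponds to a maximal block of consecutive equal directions
-- (ascent = true / descent = false) between adjacent entries.

directions : List ℕ → List Bool
directions []            = []
directions (a ∷ [])      = []
directions (a ∷ b ∷ w)   = (a <ᵇ b) ∷ directions (b ∷ w)

blocks : List Bool → ℕ
blocks []            = zero
blocks (d ∷ [])      = 1
blocks (d ∷ e ∷ ds)  = (if d Data.Bool.xor e then 1 else 0) ℕ.+ blocks (e ∷ ds)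

altrun : List ℕ → ℕ
altrun π = blocks (directions π)

Poly : Set
Poly = ℕ → ℤ

_≋_ : Poly → Poly → Set
p ≋ q = ∀ j → p j ≡ q j

_⊕_ : Poly → Poly → Poly
(p ⊕ q) j = p j + q j

sumTo : ℕ → (ℕ → ℤ) → ℤ
sumTo zero    f = f zero
sumTo (suc j) f = sumTo j f + f (suc j)

_⊛_ : Poly → Poly → Poly
(p ⊛ q) j = sumTo j (λ i → p i * q (j ∸ i))

const : ℤ → Poly
const c zero    = c
const c (suc j) = + 0

zeroP : Poly
zeroP j = + 0

X^ : ℕ → Poly
X^ k j = if k ≡ᵇ j then + 1 else + 0

_^P_ : Poly → ℕ → Poly
p ^P zero    = const (+ 1)
p ^P (suc m) = p ⊛ (p ^P m)

onePlusX : Poly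
onePlusX = const (+ 1) ⊕ X^ 1

sumP : ℕ → (ℕ → Poly) → Poly
sumP zero    f = zeroP
sumP (suc n) f = sumP n f ⊕ f (suc n)

F : ℕ → Poly
F n j = + length (filter (λ σ → T? (altrun (Φ σ) ≡ᵇ j)) (Q n))

-- γ_{n,k}: γ_{1,1}=1, γ_{1,k}=0 (k≠1),
-- γ_{n+1,k} = k γ_{n,k} + (2n-4k+5) γ_{n,k-1}, with γ_{n,-1} = 0.
-- (γ_{0,k} is not used; set to 0.)

γ : ℕ → ℕ → ℤ
γ zero k                     = + 0
γ (suc zero) k               = if k ≡ᵇ 1 then + 1 else + 0
γ (suc (suc m)) zero         = + 0   -- = 0·γ_{n,0} + (…)·γ_{n,-1} = 0
γ (suc (suc m)) (suc k)      =
  (+ suc k) * γ (suc m) (suc k)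
  + ((+ (2 ℕ.* suc m) - + (4 ℕ.* suc k)) + + 5) * γ (suc m) k

oddDoubleFact : ℕ → ℕ
oddDoubleFact zero    = 1
oddDoubleFact (suc n) = (2 ℕ.* suc n ∸ 1) ℕ.* oddDoubleFact n

module Submission where

-- Both F_n and G_n = Σ_k γ_{n,k} x^k (1+x)^{2n-2k} satisfy the recurrence
-- P_{n+1} = T_n P_n with T_n P = x(1 + 2nx) P + x(1 - x²) P' (module Operator),
-- and F_1 = G_1 = x; so they agree for all n ≥ 1 (F≋G).
--
-- G side: [x^j] x^k (1+x)^m = C(m, j-k) (Coefficients); for m + 2k = 2n,
-- T_n (x^k (1+x)^m) = k x^k (1+x)^{m+2} + (m-2k+1) x^{k+1} (1+x)^m
-- (StepOnMonomial); reindexing with the recurrence for γ then gives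
-- G_{n+1} = T_n G_n, and the diagonal γ_{n+1,n+1} (GammaExpansion).
--
-- F side: Q_{n+1} arises from Q_n by inserting (n+1)(n+1) into each of the 2n+1
-- gaps (StirlingRecursion); under Φ this inserts the peak (2n+2)(2n+1)
-- (DualInsertion).  If Φ σ has r alternating runs, the insertions have r runs
-- r times, r+1 runs once and r+2 runs 2n-r times (AlternatingRuns), and this
-- distribution is T_n x^r (RunDistribution).

open import Defs

module Coefficients where

  open import Function using (_∘_)
  open import Data.Nat as ℕ using (ℕ; zero; suc; _∸_; _≤ᵇ_)
  open import Data.Integer using (ℤ; +_; _+_; _*_)
  import Data.Nat.Properties as ℕP
  import Data.Integer.Properties as ℤP
  open import Data.Bool using (true; false; if_then_else_)
  open import Relation.Binary.PropositionalEquality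
  open ≡-Reasoning

  sumTo-cong : ∀ j {f g : ℕ → ℤ} → (∀ i → f i ≡ g i) → sumTo j f ≡ sumTo j g
  sumTo-cong zero    f≡g = f≡g zero
  sumTo-cong (suc j) f≡g = cong₂ _+_ (sumTo-cong j f≡g) (f≡g (suc j))

  sumTo-suc : ∀ j (f : ℕ → ℤ) → sumTo (suc j) f ≡ f 0 + sumTo j (f ∘ suc)
  sumTo-suc zero    f = refl
  sumTo-suc (suc j) f = begin
      sumTo (suc j) f + f (suc (suc j))
    ≡⟨ cong (_+ f (suc (suc j))) (sumTo-suc j f) ⟩
      (f 0 + sumTo j (f ∘ suc)) + f (suc (suc j))
    ≡⟨ ℤP.+-assoc (f 0) _ _ ⟩
      f 0 + sumTo (suc j) (f ∘ suc) ∎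

  sumTo-zero : ∀ j {f : ℕ → ℤ} → (∀ i → f i ≡ + 0) → sumTo j f ≡ + 0
  sumTo-zero zero    f≡0 = f≡0 zero
  sumTo-zero (suc j) f≡0 = cong₂ _+_ (sumTo-zero j f≡0) (f≡0 (suc j))

  sumTo-first : ∀ j (f : ℕ → ℤ) → (∀ i → f (suc i) ≡ + 0) → sumTo j f ≡ f 0
  sumTo-first zero    f _   = refl
  sumTo-first (suc j) f f≡0 = begin
      sumTo (suc j) f            ≡⟨ sumTo-suc j f ⟩
      f 0 + sumTo j (f ∘ suc)    ≡⟨ cong (_+_ (f 0)) (sumTo-zero j f≡0) ⟩
      f 0 + + 0                  ≡⟨ ℤP.+-identityʳ (f 0) ⟩
      f 0                        ∎

  const-⊛ : ∀ c p j → (const c ⊛ p) j ≡ c * p j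
  const-⊛ c p j = sumTo-first j (λ i → const c i * p (j ∸ i)) (λ i → ℤP.*-zeroˡ (p (j ∸ suc i)))

  ≤ᵇ-suc : ∀ k j → (suc k ≤ᵇ suc j) ≡ (k ≤ᵇ j)
  ≤ᵇ-suc zero    j = refl
  ≤ᵇ-suc (suc k) j = refl

  sumTo-X^ : ∀ k j (q : ℕ → ℤ) → sumTo j (λ i → X^ k i * q i) ≡ (if k ≤ᵇ j then q k else + 0)
  sumTo-X^ zero j q =
    trans (sumTo-first j (λ i → X^ 0 i * q i) (λ i → ℤP.*-zeroˡ (q (suc i)))) (ℤP.*-identityˡ (q 0))
  sumTo-X^ (suc k) zero q = ℤP.*-zeroˡ (q 0)
  sumTo-X^ (suc k) (suc j) q = begin
      sumTo (suc j) (λ i → X^ (suc k) i * q i)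
    ≡⟨ sumTo-suc j _ ⟩
      + 0 * q 0 + sumTo j (λ i → X^ k i * q (suc i))
    ≡⟨ cong₂ _+_ (ℤP.*-zeroˡ (q 0)) (sumTo-X^ k j (q ∘ suc)) ⟩
      + 0 + (if k ≤ᵇ j then q (suc k) else + 0)
    ≡⟨ ℤP.+-identityˡ _ ⟩
      (if k ≤ᵇ j then q (suc k) else + 0)
    ≡⟨ cong (λ b → if b then q (suc k) else + 0) (sym (≤ᵇ-suc k j)) ⟩
      (if suc k ≤ᵇ suc j then q (suc k) else + 0) ∎

  X^-⊛ : ∀ k p j → (X^ k ⊛ p) j ≡ (if k ≤ᵇ j then p (j ∸ k) else + 0)
  X^-⊛ k p j = sumTo-X^ k j (λ i → p (j ∸ i))

  -- Binomial coefficients, by Pascal's rule (this definition computes on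
  -- small arguments, which the proofs below rely on).
  binomial : ℕ → ℕ → ℕ
  binomial m       zero    = 1
  binomial zero    (suc k) = 0
  binomial (suc m) (suc k) = binomial m k ℕ.+ binomial m (suc k)

  sumTo-onePlusX : ∀ j (q : ℕ → ℤ) → sumTo (suc j) (λ i → onePlusX i * q i) ≡ q 0 + q 1
  sumTo-onePlusX j q = begin
      sumTo (suc j) (λ i → onePlusX i * q i)
    ≡⟨ sumTo-suc j _ ⟩
      + 1 * q 0 + sumTo j (λ i → (+ 0 + X^ 0 i) * q (suc i))
    ≡⟨ cong₂ _+_ (ℤP.*-identityˡ (q 0))
                 (sumTo-cong j (λ i → cong (_* q (suc i)) (ℤP.+-identityˡ (X^ 0 i)))) ⟩
      q 0 + sumTo j (λ i → X^ 0 i * q (suc i))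
    ≡⟨ cong (_+_ (q 0)) (sumTo-X^ 0 j (q ∘ suc)) ⟩
      q 0 + q 1 ∎

  onePlusX^-coeff : ∀ m j → (onePlusX ^P m) j ≡ + binomial m j
  onePlusX^-coeff zero    zero    = refl
  onePlusX^-coeff zero    (suc j) = refl
  onePlusX^-coeff (suc m) zero    = trans (ℤP.*-identityˡ _) (onePlusX^-coeff m 0)
  onePlusX^-coeff (suc m) (suc j) = begin
      sumTo (suc j) (λ i → onePlusX i * (onePlusX ^P m) (suc j ∸ i))
    ≡⟨ sumTo-onePlusX j _ ⟩
      (onePlusX ^P m) (suc j) + (onePlusX ^P m) j
    ≡⟨ cong₂ _+_ (onePlusX^-coeff m (suc j)) (onePlusX^-coeff m j) ⟩
      + binomial m (suc j) + + binomial m j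
    ≡⟨ ℤP.+-comm (+ binomial m (suc j)) (+ binomial m j) ⟩
      + (binomial m j ℕ.+ binomial m (suc j)) ∎

  -- [x^j] x^k (1+x)^m.
  monomial : ℕ → ℕ → Poly
  monomial m k j = if k ≤ᵇ j then + binomial m (j ∸ k) else + 0

  term-coeff : ∀ c k m j → (const c ⊛ (X^ k ⊛ (onePlusX ^P m))) j ≡ c * monomial m k j
  term-coeff c k m j = begin
      (const c ⊛ (X^ k ⊛ (onePlusX ^P m))) j
    ≡⟨ const-⊛ c (X^ k ⊛ (onePlusX ^P m)) j ⟩
      c * (X^ k ⊛ (onePlusX ^P m)) j
    ≡⟨ cong (c *_) (X^-⊛ k (onePlusX ^P m) j) ⟩
      c * (if k ≤ᵇ j then (onePlusX ^P m) (j ∸ k) else + 0)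
    ≡⟨ cong (c *_) (shifted (k ≤ᵇ j)) ⟩
      c * monomial m k j ∎
    where
    shifted : ∀ b → (if b then (onePlusX ^P m) (j ∸ k) else + 0) ≡ (if b then + binomial m (j ∸ k) else + 0)
    shifted true  = onePlusX^-coeff m (j ∸ k)
    shifted false = refl

  Σ₁ : ℕ → (ℕ → ℤ) → ℤ
  Σ₁ zero    f = + 0
  Σ₁ (suc n) f = Σ₁ n f + f (suc n)

  sumP-coeff : ∀ n f j → sumP n f j ≡ Σ₁ n (λ k → f k j)
  sumP-coeff zero    f j = refl
  sumP-coeff (suc n) f j = cong (_+ f (suc n) j) (sumP-coeff n f j)

  Σ₁-cong : ∀ n {f g : ℕ → ℤ} → (∀ k → 1 ℕ.≤ k → k ℕ.≤ n → f k ≡ g k) → Σ₁ n f ≡ Σ₁ n g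
  Σ₁-cong zero    f≡g = refl
  Σ₁-cong (suc n) f≡g =
    cong₂ _+_ (Σ₁-cong n (λ k 1≤k k≤n → f≡g k 1≤k (ℕP.m≤n⇒m≤1+n k≤n))) (f≡g (suc n) (ℕ.s≤s ℕ.z≤n) ℕP.≤-refl)

  G : ℕ → Poly
  G n j = Σ₁ n (λ k → γ n k * monomial (2 ℕ.* n ∸ 2 ℕ.* k) k j)

  G-coeff : ∀ n j → sumP n (λ k → const (γ n k) ⊛ (X^ k ⊛ (onePlusX ^P (2 ℕ.* n ∸ 2 ℕ.* k)))) j ≡ G n j
  G-coeff n j = trans (sumP-coeff n _ j) (Σ₁-cong n (λ k _ _ → term-coeff (γ n k) k _ j))

module Operator where

  open Coefficients

  open import Data.Nat as ℕ using (ℕ; zero; suc; _≤_)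
  import Data.Nat.Properties as ℕP
  open import Data.Integer using (+_; _+_; _*_; _-_)
  import Data.Integer.Properties as ℤP
  open import Relation.Binary.PropositionalEquality
  import Data.Integer.Tactic.RingSolver as ℤ-Solver

  -- The operator T_n P = x(1 + 2nx) P + x(1 - x²) P', coefficientwise.
  -- Both sides of the theorem satisfy P_{n+1} = T_n P_n.
  step : ℕ → Poly → Poly
  step n P zero          = + 0
  step n P (suc zero)    = P 1 + P 0
  step n P (suc (suc i)) = + suc (suc i) * P (suc (suc i)) + P (suc i) + (+ (2 ℕ.* n) - + i) * P i

  step-cong : ∀ n {P Q : Poly} → P ≋ Q → step n P ≋ step n Q
  step-cong n P≋Q zero          = refl
  step-cong n P≋Q (suc zero)    = cong₂ _+_ (P≋Q 1) (P≋Q 0)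
  step-cong n P≋Q (suc (suc i)) =
    cong₂ _+_ (cong₂ _+_ (cong (_*_ (+ suc (suc i))) (P≋Q (suc (suc i)))) (P≋Q (suc i)))
              (cong (_*_ (+ (2 ℕ.* n) - + i)) (P≋Q i))

  step-+ : ∀ n (P Q : Poly) → step n (P ⊕ Q) ≋ (step n P ⊕ step n Q)
  step-+ n P Q zero          = refl
  step-+ n P Q (suc zero)    = interchange (P 1) (Q 1) (P 0) (Q 0)
    where
    interchange : ∀ a b c d → (a + b) + (c + d) ≡ (a + c) + (b + d)
    interchange = ℤ-Solver.solve-∀
  step-+ n P Q (suc (suc i)) =
    distrib (+ suc (suc i)) (+ (2 ℕ.* n) - + i) (P _) (Q _) (P _) (Q _) (P i) (Q i)
    where
    distrib : ∀ x y a b c d e f → x * (a + b) + (c + d) + y * (e + f) ≡ (x * a + c + y * e) + (x * b + d + y * f)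
    distrib = ℤ-Solver.solve-∀

  step-scale : ∀ n c (P : Poly) j → step n (λ i → c * P i) j ≡ c * step n P j
  step-scale n c P zero          = sym (ℤP.*-zeroʳ c)
  step-scale n c P (suc zero)    = sym (ℤP.*-distribˡ-+ c (P 1) (P 0))
  step-scale n c P (suc (suc i)) = factor (+ suc (suc i)) (+ (2 ℕ.* n) - + i) c (P _) (P _) (P i)
    where
    factor : ∀ x y c a b e → x * (c * a) + c * b + y * (c * e) ≡ c * (x * a + b + y * e)
    factor = ℤ-Solver.solve-∀

  step-vanishes : ∀ n P j → (∀ i → i ≤ j → P i ≡ + 0) → step n P j ≡ + 0
  step-vanishes n P zero          P≡0 = refl
  step-vanishes n P (suc zero)    P≡0 = cong₂ _+_ (P≡0 1 ℕP.≤-refl) (P≡0 0 ℕ.z≤n)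
  step-vanishes n P (suc (suc i)) P≡0 = begin
      + suc (suc i) * P (suc (suc i)) + P (suc i) + (+ (2 ℕ.* n) - + i) * P i
    ≡⟨ cong₂ _+_ (cong₂ _+_ (cong (_*_ (+ suc (suc i))) (P≡0 (suc (suc i)) ℕP.≤-refl))
                            (P≡0 (suc i) (ℕP.n≤1+n _)))
                 (cong (_*_ (+ (2 ℕ.* n) - + i)) (P≡0 i (ℕP.m≤n⇒m≤1+n (ℕP.n≤1+n i)))) ⟩
      + suc (suc i) * + 0 + + 0 + (+ (2 ℕ.* n) - + i) * + 0
    ≡⟨ cong₂ _+_ (cong (_+ + 0) (ℤP.*-zeroʳ (+ suc (suc i)))) (ℤP.*-zeroʳ (+ (2 ℕ.* n) - + i)) ⟩
      + 0 ∎
    where open ≡-Reasoning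

  step-Σ₁ : ∀ n N (f : ℕ → Poly) j → step n (λ i → Σ₁ N (λ k → f k i)) j ≡ Σ₁ N (λ k → step n (f k) j)
  step-Σ₁ n zero    f j = step-vanishes n (λ _ → + 0) j (λ _ _ → refl)
  step-Σ₁ n (suc N) f j =
    trans (step-+ n (λ i → Σ₁ N (λ k → f k i)) (f (suc N)) j)
          (cong (_+ step n (f (suc N)) j) (step-Σ₁ n N f j))

module StepOnMonomial where

  open Coefficients
  open Operator

  open import Data.Nat as ℕ using (ℕ; zero; suc; _∸_; _≤ᵇ_; _<_; _≤?_)
  import Data.Nat.Properties as ℕP
  open import Data.Integer using (+_; _+_; _*_; _-_)
  import Data.Integer.Properties as ℤP
  open import Data.Bool using (true; false)
  open import Relation.Nullary using (yes; no)
  open import Relation.Binary.PropositionalEquality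
  open ≡-Reasoning
  import Data.Nat.Tactic.RingSolver as ℕ-Solver
  import Data.Integer.Tactic.RingSolver as ℤ-Solver

  binomial-one : ∀ m → binomial m 1 ≡ m
  binomial-one zero    = refl
  binomial-one (suc m) = cong suc (binomial-one m)

  binomial-absorb : ∀ m t → suc t ℕ.* binomial m (suc t) ℕ.+ t ℕ.* binomial m t ≡ m ℕ.* binomial m t
  binomial-absorb zero    zero    = refl
  binomial-absorb zero    (suc t) = cong₂ ℕ._+_ (ℕP.*-zeroʳ (suc (suc t))) (ℕP.*-zeroʳ (suc t))
  binomial-absorb (suc m) zero    = begin
      1 ℕ.* binomial (suc m) 1 ℕ.+ 0 ≡⟨ ℕP.+-identityʳ _ ⟩
      binomial (suc m) 1 ℕ.+ 0       ≡⟨ ℕP.+-identityʳ _ ⟩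
      binomial (suc m) 1             ≡⟨ binomial-one (suc m) ⟩
      suc m                          ≡⟨ ℕP.*-identityʳ (suc m) ⟨
      suc m ℕ.* 1                    ∎
  binomial-absorb (suc m) (suc t) = begin
      suc (suc t) ℕ.* (B ℕ.+ C) ℕ.+ suc t ℕ.* (A ℕ.+ B)
    ≡⟨ regroup t A B C ⟩
      (suc (suc t) ℕ.* C ℕ.+ suc t ℕ.* B) ℕ.+ (suc t ℕ.* B ℕ.+ t ℕ.* A) ℕ.+ A ℕ.+ B
    ≡⟨ cong₂ (λ u v → u ℕ.+ v ℕ.+ A ℕ.+ B) (binomial-absorb m (suc t)) (binomial-absorb m t) ⟩
      m ℕ.* B ℕ.+ m ℕ.* A ℕ.+ A ℕ.+ B
    ≡⟨ collect m A B ⟩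
      suc m ℕ.* (A ℕ.+ B) ∎
    where
    A = binomial m t
    B = binomial m (suc t)
    C = binomial m (suc (suc t))
    regroup : ∀ t A B C → suc (suc t) ℕ.* (B ℕ.+ C) ℕ.+ suc t ℕ.* (A ℕ.+ B)
                         ≡ (suc (suc t) ℕ.* C ℕ.+ suc t ℕ.* B) ℕ.+ (suc t ℕ.* B ℕ.+ t ℕ.* A) ℕ.+ A ℕ.+ B
    regroup = ℕ-Solver.solve-∀
    collect : ∀ m A B → m ℕ.* B ℕ.+ m ℕ.* A ℕ.+ A ℕ.+ B ≡ suc m ℕ.* (A ℕ.+ B)
    collect = ℕ-Solver.solve-∀

  binomial-absorbℤ : ∀ m t → + suc t * + binomial m (suc t) + + t * + binomial m t ≡ + m * + binomial m t
  binomial-absorbℤ m t = begin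
      + suc t * + binomial m (suc t) + + t * + binomial m t
    ≡⟨ cong₂ _+_ (ℤP.pos-* (suc t) _) (ℤP.pos-* t _) ⟨
      + (suc t ℕ.* binomial m (suc t)) + + (t ℕ.* binomial m t)
    ≡⟨ ℤP.pos-+ (suc t ℕ.* binomial m (suc t)) _ ⟨
      + (suc t ℕ.* binomial m (suc t) ℕ.+ t ℕ.* binomial m t)
    ≡⟨ cong +_ (binomial-absorb m t) ⟩
      + (m ℕ.* binomial m t)
    ≡⟨ ℤP.pos-* m _ ⟩
      + m * + binomial m t ∎

  k≤ᵇk+x : ∀ k x → (k ≤ᵇ k ℕ.+ x) ≡ true
  k≤ᵇk+x zero    x = refl
  k≤ᵇk+x (suc k) x = trans (≤ᵇ-suc k (k ℕ.+ x)) (k≤ᵇk+x k x)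

  j<k⇒k≰ᵇj : ∀ k j → j < k → (k ≤ᵇ j) ≡ false
  j<k⇒k≰ᵇj (suc k) zero    _            = refl
  j<k⇒k≰ᵇj (suc k) (suc j) (ℕ.s≤s j<k) = trans (≤ᵇ-suc k j) (j<k⇒k≰ᵇj k j j<k)

  monomial-at : ∀ m k x {j} → j ≡ k ℕ.+ x → monomial m k j ≡ + binomial m x
  monomial-at m k x refl rewrite k≤ᵇk+x k x | ℕP.m+n∸m≡n k x = refl

  monomial-below : ∀ m k j → j < k → monomial m k j ≡ + 0
  monomial-below m k j j<k rewrite j<k⇒k≰ᵇj k j j<k = refl

  -- The claimed image of x^k (1+x)^m under T_n.
  stepImage : ℕ → ℕ → Poly
  stepImage m k j = + k * monomial (suc (suc m)) k j + (+ m - + (2 ℕ.* k) + + 1) * monomial m (suc k) j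

  step-monomial-below : ∀ n m k j → j < k → step n (monomial m k) j ≡ stepImage m k j
  step-monomial-below n m k j j<k = begin
      step n (monomial m k) j
    ≡⟨ step-vanishes n (monomial m k) j (λ i i≤j → monomial-below m k i (ℕP.≤-<-trans i≤j j<k)) ⟩
      + 0
    ≡⟨ cong₂ _+_ (ℤP.*-zeroʳ (+ k)) (ℤP.*-zeroʳ (+ m - + (2 ℕ.* k) + + 1)) ⟨
      + k * + 0 + (+ m - + (2 ℕ.* k) + + 1) * + 0
    ≡⟨ cong₂ (λ u v → + k * u + (+ m - + (2 ℕ.* k) + + 1) * v)
             (monomial-below (suc (suc m)) k j j<k) (monomial-below m (suc k) j (ℕP.<-trans j<k (ℕP.n<1+n k))) ⟨
      stepImage m k j ∎

  step-monomial-diag : ∀ n m k → step n (monomial m k) k ≡ stepImage m k k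
  step-monomial-diag n m zero          = sym (cong (_+_ (+ 0)) (ℤP.*-zeroʳ (+ m - + 0 + + 1)))
  step-monomial-diag n m (suc zero)    = sym (cong (_+_ (+ 1)) (ℤP.*-zeroʳ (+ m - + 2 + + 1)))
  step-monomial-diag n m (suc (suc k)) = begin
      + k+2 * monomial m k+2 k+2 + monomial m k+2 (suc k) + c * monomial m k+2 k
    ≡⟨ cong₂ _+_ (cong₂ _+_ (cong (_*_ (+ k+2)) (monomial-at m k+2 0 k+2≡k+2+0))
                            (monomial-below m k+2 (suc k) (ℕP.n<1+n _)))
                 (cong (_*_ c) (monomial-below m k+2 k (ℕP.<-trans (ℕP.n<1+n _) (ℕP.n<1+n _)))) ⟩
      + k+2 * + 1 + + 0 + c * + 0
    ≡⟨ dropZeros (+ k+2 * + 1) c d ⟩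
      + k+2 * + 1 + d * + 0
    ≡⟨ cong₂ (λ u v → + k+2 * u + d * v) (monomial-at (suc (suc m)) k+2 0 k+2≡k+2+0)
                                         (monomial-below m (suc k+2) k+2 (ℕP.n<1+n _)) ⟨
      stepImage m k+2 k+2 ∎
    where
    k+2 = suc (suc k)
    c = + (2 ℕ.* n) - + k
    d = + m - + (2 ℕ.* k+2) + + 1
    k+2≡k+2+0 : k+2 ≡ k+2 ℕ.+ 0
    k+2≡k+2+0 = sym (ℕP.+-identityʳ k+2)
    dropZeros : ∀ a c d → a + + 0 + c * + 0 ≡ a + d * + 0
    dropZeros = ℤ-Solver.solve-∀

  step-monomial-next : ∀ n m k → step n (monomial m k) (suc k) ≡ stepImage m k (suc k)
  step-monomial-next n m zero = begin
      + binomial m 1 + + 1          ≡⟨ cong (λ u → + u + + 1) (binomial-one m) ⟩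
      + m + + 1                     ≡⟨ algebra (+ m) (+ binomial (suc (suc m)) 1) ⟩
      stepImage m 0 1               ∎
    where
    algebra : ∀ M X → M + + 1 ≡ + 0 * X + (M - + 0 + + 1) * + 1
    algebra = ℤ-Solver.solve-∀
  step-monomial-next n m (suc k) = begin
      + suc (suc k) * monomial m (suc k) (suc (suc k)) + monomial m (suc k) (suc k) + c * monomial m (suc k) k
    ≡⟨ cong₂ _+_ (cong₂ _+_ (cong₂ _*_ (ℤP.pos-+ 2 k) (trans (monomial-at m (suc k) 1 (cong suc (ℕP.+-comm 1 k)))
                                                                (cong +_ (binomial-one m))))
                            (monomial-at m (suc k) 0 (sym (ℕP.+-identityʳ _))))
                 (cong (_*_ c) (monomial-below m (suc k) k (ℕP.n<1+n k))) ⟩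
      (+ 2 + + k) * + m + + 1 + c * + 0
    ≡⟨ algebra (+ k) (+ m) c ⟩
      (+ 1 + + k) * (+ 2 + + m) + (+ m - + 2 * (+ 1 + + k) + + 1) * + 1
    ≡⟨ cong₂ (λ u v → u * v + (+ m - + 2 * (+ 1 + + k) + + 1) * + 1) (ℤP.pos-+ 1 k)
             (trans (monomial-at (suc (suc m)) (suc k) 1 (cong suc (ℕP.+-comm 1 k)))
                    (trans (cong +_ (binomial-one (suc (suc m)))) (ℤP.pos-+ 2 m))) ⟨
      + suc k * monomial (suc (suc m)) (suc k) (suc (suc k)) + (+ m - + 2 * (+ 1 + + k) + + 1) * + 1
    ≡⟨ cong₂ (λ u v → + suc k * monomial (suc (suc m)) (suc k) (suc (suc k)) + (+ m - u + + 1) * v)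
             (trans (ℤP.pos-* 2 (suc k)) (cong (_*_ (+ 2)) (ℤP.pos-+ 1 k)))
             (monomial-at m (suc (suc k)) 0 (sym (ℕP.+-identityʳ _))) ⟨
      stepImage m (suc k) (suc (suc k)) ∎
    where
    c = + (2 ℕ.* n) - + k
    algebra : ∀ K M c → (+ 2 + K) * M + + 1 + c * + 0 ≡ (+ 1 + K) * (+ 2 + M) + (M - + 2 * (+ 1 + K) + + 1) * + 1
    algebra = ℤ-Solver.solve-∀

  -- The algebra behind the generic coefficient x^{k+t+2}, where A, B, C stand for
  -- C(m,t), C(m,t+1), C(m,t+2): given the two absorption identities, the
  -- coefficients of T_n(x^k(1+x)^m) and of the claimed image agree.
  far-identity : ∀ K T M A B C → M * A ≡ (+ 1 + T) * B + T * A → M * B ≡ (+ 2 + T) * C + (+ 1 + T) * B →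
                 (+ 2 + (K + T)) * C + B + ((M + + 2 * K) - (K + T)) * A ≡ K * ((A + B) + (B + C)) + (M - + 2 * K + + 1) * B
  far-identity K T M A B C absorbA absorbB = begin
      (+ 2 + (K + T)) * C + B + ((M + + 2 * K) - (K + T)) * A
    ≡⟨ isolate K T M A B C ⟩
      (+ 2 + (K + T)) * C + B + (K - T) * A + M * A
    ≡⟨ cong (_+_ ((+ 2 + (K + T)) * C + B + (K - T) * A)) absorbA ⟩
      (+ 2 + (K + T)) * C + B + (K - T) * A + ((+ 1 + T) * B + T * A)
    ≡⟨ regroup K T M A B C ⟩
      K * ((A + B) + (B + C)) + (+ 1 - + 2 * K) * B + ((+ 2 + T) * C + (+ 1 + T) * B)
    ≡⟨ cong (_+_ (K * ((A + B) + (B + C)) + (+ 1 - + 2 * K) * B)) absorbB ⟨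
      K * ((A + B) + (B + C)) + (+ 1 - + 2 * K) * B + M * B
    ≡⟨ collect K M A B C ⟩
      K * ((A + B) + (B + C)) + (M - + 2 * K + + 1) * B ∎
    where
    isolate : ∀ K T M A B C → (+ 2 + (K + T)) * C + B + ((M + + 2 * K) - (K + T)) * A
                              ≡ (+ 2 + (K + T)) * C + B + (K - T) * A + M * A
    isolate = ℤ-Solver.solve-∀
    regroup : ∀ K T M A B C → (+ 2 + (K + T)) * C + B + (K - T) * A + ((+ 1 + T) * B + T * A)
                              ≡ K * ((A + B) + (B + C)) + (+ 1 - + 2 * K) * B + ((+ 2 + T) * C + (+ 1 + T) * B)
    regroup = ℤ-Solver.solve-∀
    collect : ∀ K M A B C → K * ((A + B) + (B + C)) + (+ 1 - + 2 * K) * B + M * B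
                            ≡ K * ((A + B) + (B + C)) + (M - + 2 * K + + 1) * B
    collect = ℤ-Solver.solve-∀

  step-monomial-far : ∀ n m k t → m ℕ.+ 2 ℕ.* k ≡ 2 ℕ.* n →
                      step n (monomial m k) (suc (suc (k ℕ.+ t))) ≡ stepImage m k (suc (suc (k ℕ.+ t)))
  step-monomial-far n m k t m+2k≡2n = begin
      + suc (suc (k ℕ.+ t)) * monomial m k (suc (suc (k ℕ.+ t))) + monomial m k (suc (k ℕ.+ t))
        + (+ (2 ℕ.* n) - + (k ℕ.+ t)) * monomial m k (k ℕ.+ t)
    ≡⟨ cong₂ _+_ (cong₂ _+_ (cong₂ _*_ (trans (ℤP.pos-+ 2 (k ℕ.+ t)) (cong (_+_ (+ 2)) (ℤP.pos-+ k t)))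
                                       (monomial-at m k (suc (suc t)) k+t+2))
                            (monomial-at m k (suc t) k+t+1))
                 (cong₂ _*_ (cong₂ _-_ 2n≡M+2K (ℤP.pos-+ k t)) (monomial-at m k t refl)) ⟩
      (+ 2 + (K + T)) * C + B + ((M + + 2 * K) - (K + T)) * A
    ≡⟨ far-identity K T M A B C (absorbℤ t) (absorbℤ (suc t)) ⟩
      K * ((A + B) + (B + C)) + (M - + 2 * K + + 1) * B
    ≡⟨ cong₂ _+_ (cong (_*_ K) (trans (monomial-at (suc (suc m)) k (suc (suc t)) k+t+2) C[m+2,t+2]))
                 (cong₂ (λ u v → (M - u + + 1) * v) (ℤP.pos-* 2 k) (monomial-at m (suc k) (suc t) (cong suc k+t+1))) ⟨
      stepImage m k (suc (suc (k ℕ.+ t))) ∎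
    where
    K = + k
    T = + t
    M = + m
    A = + binomial m t
    B = + binomial m (suc t)
    C = + binomial m (suc (suc t))
    k+t+1 : suc (k ℕ.+ t) ≡ k ℕ.+ suc t
    k+t+1 = sym (ℕP.+-suc k t)
    k+t+2 : suc (suc (k ℕ.+ t)) ≡ k ℕ.+ suc (suc t)
    k+t+2 = trans (cong suc k+t+1) (sym (ℕP.+-suc k (suc t)))
    2n≡M+2K : + (2 ℕ.* n) ≡ M + + 2 * K
    2n≡M+2K = trans (cong +_ (sym m+2k≡2n)) (trans (ℤP.pos-+ m (2 ℕ.* k)) (cong (_+_ M) (ℤP.pos-* 2 k)))
    C[m+2,t+2] : + binomial (suc (suc m)) (suc (suc t)) ≡ (A + B) + (B + C)
    C[m+2,t+2] = trans (ℤP.pos-+ (binomial m t ℕ.+ binomial m (suc t)) _)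
                       (cong₂ _+_ (ℤP.pos-+ (binomial m t) _) (ℤP.pos-+ (binomial m (suc t)) _))
    absorbℤ : ∀ s → M * + binomial m s ≡ (+ 1 + + s) * + binomial m (suc s) + + s * + binomial m s
    absorbℤ s = trans (sym (binomial-absorbℤ m s)) (cong (λ u → u * + binomial m (suc s) + + s * + binomial m s) (ℤP.pos-+ 1 s))

  step-monomial : ∀ n m k → m ℕ.+ 2 ℕ.* k ≡ 2 ℕ.* n → step n (monomial m k) ≋ stepImage m k
  step-monomial n m k m+2k≡2n j with k ≤? j
  ... | no k≰j  = step-monomial-below n m k j (ℕP.≰⇒> k≰j)
  ... | yes k≤j = subst Agrees (ℕP.m+[n∸m]≡n k≤j) (above (j ∸ k))
    where
    Agrees : ℕ → Set
    Agrees j = step n (monomial m k) j ≡ stepImage m k j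
    above : ∀ x → Agrees (k ℕ.+ x)
    above zero          = subst Agrees (sym (ℕP.+-identityʳ k)) (step-monomial-diag n m k)
    above (suc zero)    = subst Agrees (ℕP.+-comm 1 k) (step-monomial-next n m k)
    above (suc (suc t)) = subst Agrees (sym (trans (ℕP.+-suc k (suc t)) (cong suc (ℕP.+-suc k t))))
                                (step-monomial-far n m k t m+2k≡2n)

-- The γ-expansion G_n satisfies G_{n+1} = T_n G_n: expanding γ_{n+1,k} by its
-- recurrence splits G_{n+1} into two sums, which are exactly the two halves of
-- Σ_k γ_{n,k} T_n(x^k (1+x)^{2n-2k}) given by step-monomial.
module GammaExpansion where

  open Coefficients
  open Operator
  open StepOnMonomial

  open import Function using (_∘_)
  open import Data.Nat as ℕ using (ℕ; zero; suc; _∸_; _<_; _≤_)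
  import Data.Nat.Properties as ℕP
  open import Data.Integer using (ℤ; +_; -_; _+_; _*_; _-_; _^_)
  import Data.Integer.Properties as ℤP
  open import Relation.Binary.PropositionalEquality
  open ≡-Reasoning
  import Data.Nat.Tactic.RingSolver as ℕ-Solver
  import Data.Integer.Tactic.RingSolver as ℤ-Solver

  Σ₁-+ : ∀ N (f g : ℕ → ℤ) → Σ₁ N (λ k → f k + g k) ≡ Σ₁ N f + Σ₁ N g
  Σ₁-+ zero    f g = refl
  Σ₁-+ (suc N) f g = trans (cong (_+ (f (suc N) + g (suc N))) (Σ₁-+ N f g)) (interchange (Σ₁ N f) (Σ₁ N g) _ _)
    where
    interchange : ∀ a b c d → (a + b) + (c + d) ≡ (a + c) + (b + d)
    interchange = ℤ-Solver.solve-∀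

  Σ₁-suc : ∀ N (f : ℕ → ℤ) → Σ₁ (suc N) f ≡ f 1 + Σ₁ N (f ∘ suc)
  Σ₁-suc zero    f = trans (ℤP.+-identityˡ (f 1)) (sym (ℤP.+-identityʳ (f 1)))
  Σ₁-suc (suc N) f = trans (cong (_+ f (suc (suc N))) (Σ₁-suc N f)) (ℤP.+-assoc (f 1) _ _)

  γ-above : ∀ n k → n < k → γ n k ≡ + 0
  γ-above zero          k             _             = refl
  γ-above (suc zero)    (suc zero)    (ℕ.s≤s ())
  γ-above (suc zero)    (suc (suc k)) _             = refl
  γ-above (suc (suc n)) (suc k)       (ℕ.s≤s n<k) = begin
      + suc k * γ (suc n) (suc k) + c * γ (suc n) k
    ≡⟨ cong₂ _+_ (cong (_*_ (+ suc k)) (γ-above (suc n) (suc k) (ℕP.<-trans n<k (ℕP.n<1+n k))))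
                 (cong (_*_ c) (γ-above (suc n) k n<k)) ⟩
      + suc k * + 0 + c * + 0
    ≡⟨ cong₂ _+_ (ℤP.*-zeroʳ (+ suc k)) (ℤP.*-zeroʳ c) ⟩
      + 0 ∎
    where c = (+ (2 ℕ.* suc n) - + (4 ℕ.* suc k)) + + 5

  γ-zero : ∀ n → γ n 0 ≡ + 0
  γ-zero zero          = refl
  γ-zero (suc zero)    = refl
  γ-zero (suc (suc n)) = refl

  2[1+n] : ∀ n → 2 ℕ.* suc n ≡ suc (suc (2 ℕ.* n))
  2[1+n] = ℕ-Solver.solve-∀

  gap : ℕ → ℕ → ℕ
  gap n k = 2 ℕ.* n ∸ 2 ℕ.* k

  gap+2k : ∀ n k → k ≤ n → gap n k ℕ.+ 2 ℕ.* k ≡ 2 ℕ.* n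
  gap+2k n k k≤n = ℕP.m∸n+n≡m (ℕP.*-monoʳ-≤ 2 k≤n)

  keepPart shiftPart : ℕ → ℕ → ℤ
  keepPart  n j = Σ₁ n (λ k → γ n k * (+ k * monomial (suc (suc (gap n k))) k j))
  shiftPart n j = Σ₁ n (λ k → γ n k * ((+ gap n k - + (2 ℕ.* k) + + 1) * monomial (gap n k) (suc k) j))

  step-G : ∀ n j → step n (G n) j ≡ keepPart n j + shiftPart n j
  step-G n j = begin
      step n (G n) j
    ≡⟨ step-Σ₁ n n (λ k i → γ n k * monomial (gap n k) k i) j ⟩
      Σ₁ n (λ k → step n (λ i → γ n k * monomial (gap n k) k i) j)
    ≡⟨ Σ₁-cong n (λ k _ k≤n → begin
          step n (λ i → γ n k * monomial (gap n k) k i) j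
        ≡⟨ step-scale n (γ n k) (monomial (gap n k) k) j ⟩
          γ n k * step n (monomial (gap n k) k) j
        ≡⟨ cong (_*_ (γ n k)) (step-monomial n (gap n k) k (gap+2k n k k≤n) j) ⟩
          γ n k * stepImage (gap n k) k j
        ≡⟨ ℤP.*-distribˡ-+ (γ n k) _ _ ⟩
          γ n k * (+ k * monomial (suc (suc (gap n k))) k j)
            + γ n k * ((+ gap n k - + (2 ℕ.* k) + + 1) * monomial (gap n k) (suc k) j) ∎) ⟩
      Σ₁ n (λ k → γ n k * (+ k * monomial (suc (suc (gap n k))) k j)
                 + γ n k * ((+ gap n k - + (2 ℕ.* k) + + 1) * monomial (gap n k) (suc k) j))
    ≡⟨ Σ₁-+ n _ _ ⟩
      keepPart n j + shiftPart n j ∎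

  γ-keep γ-shift : ℕ → ℕ → ℤ
  γ-keep  n k       = + k * γ n k
  γ-shift n zero    = + 0
  γ-shift n (suc k) = ((+ (2 ℕ.* n) - + (4 ℕ.* suc k)) + + 5) * γ n k

  γ-suc : ∀ n k → 1 ≤ k → γ (suc (suc n)) k ≡ γ-keep (suc n) k + γ-shift (suc n) k
  γ-suc n (suc k) _ = refl

  module Recurrence (n′ j : ℕ) where

    n = suc n′

    keepTerm shiftTerm : ℕ → ℤ
    keepTerm  k = γ-keep n k * monomial (gap (suc n) k) k j
    shiftTerm k = γ-shift n k * monomial (gap (suc n) k) k j

    G-suc-split : G (suc n) j ≡ Σ₁ (suc n) keepTerm + Σ₁ (suc n) shiftTerm
    G-suc-split = trans (Σ₁-cong (suc n) split) (Σ₁-+ (suc n) keepTerm shiftTerm)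
      where
      split : ∀ k → 1 ≤ k → k ≤ suc n → γ (suc n) k * monomial (gap (suc n) k) k j ≡ keepTerm k + shiftTerm k
      split k 1≤k _ = trans (cong (_* monomial (gap (suc n) k) k j) (γ-suc n′ k 1≤k)) (ℤP.*-distribʳ-+ (monomial (gap (suc n) k) k j) (γ-keep n k) (γ-shift n k))

    -- The top summand k = n+1 vanishes since γ_{n,n+1} = 0; the others are the terms of keepPart.
    keep-sum : Σ₁ (suc n) keepTerm ≡ keepPart n j
    keep-sum = begin
        Σ₁ n keepTerm + keepTerm (suc n)   ≡⟨ cong (_+_ (Σ₁ n keepTerm)) top ⟩
        Σ₁ n keepTerm + + 0                ≡⟨ ℤP.+-identityʳ _ ⟩
        Σ₁ n keepTerm                      ≡⟨ Σ₁-cong n term ⟩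
        keepPart n j                       ∎
      where
      top : keepTerm (suc n) ≡ + 0
      top = begin
          + suc n * γ n (suc n) * monomial (gap (suc n) (suc n)) (suc n) j
        ≡⟨ cong (λ z → + suc n * z * monomial (gap (suc n) (suc n)) (suc n) j) (γ-above n (suc n) (ℕP.n<1+n n)) ⟩
          + suc n * + 0 * monomial (gap (suc n) (suc n)) (suc n) j
        ≡⟨ cong (_* monomial (gap (suc n) (suc n)) (suc n) j) (ℤP.*-zeroʳ (+ suc n)) ⟩
          + 0 * monomial (gap (suc n) (suc n)) (suc n) j
        ≡⟨ ℤP.*-zeroˡ (monomial (gap (suc n) (suc n)) (suc n) j) ⟩
          + 0 ∎
      reassoc : ∀ a b c → a * b * c ≡ b * (a * c)
      reassoc = ℤ-Solver.solve-∀
      term : ∀ k → 1 ≤ k → k ≤ n → keepTerm k ≡ γ n k * (+ k * monomial (suc (suc (gap n k))) k j)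
      term k _ k≤n = trans (reassoc (+ k) (γ n k) _) (cong (λ e → γ n k * (+ k * monomial e k j)) gap-suc)
        where
        gap-suc : gap (suc n) k ≡ suc (suc (gap n k))
        gap-suc = trans (cong (_∸ 2 ℕ.* k) (2[1+n] n)) (ℕP.+-∸-assoc 2 (ℕP.*-monoʳ-≤ 2 k≤n))

    -- The bottom summand k = 1 vanishes since γ_{n,0} = 0; after the shift k ↦ k+1
    -- the others are the terms of shiftPart.
    shift-sum : Σ₁ (suc n) shiftTerm ≡ shiftPart n j
    shift-sum = begin
        Σ₁ (suc n) shiftTerm                       ≡⟨ Σ₁-suc n shiftTerm ⟩
        shiftTerm 1 + Σ₁ n (shiftTerm ∘ suc)       ≡⟨ cong (_+ Σ₁ n (shiftTerm ∘ suc)) bottom ⟩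
        + 0 + Σ₁ n (shiftTerm ∘ suc)               ≡⟨ ℤP.+-identityˡ _ ⟩
        Σ₁ n (shiftTerm ∘ suc)                     ≡⟨ Σ₁-cong n term ⟩
        shiftPart n j                              ∎
      where
      bottom : shiftTerm 1 ≡ + 0
      bottom = begin
          c * γ n 0 * monomial (gap (suc n) 1) 1 j   ≡⟨ cong (λ z → c * z * monomial (gap (suc n) 1) 1 j) (γ-zero n) ⟩
          c * + 0 * monomial (gap (suc n) 1) 1 j     ≡⟨ cong (_* monomial (gap (suc n) 1) 1 j) (ℤP.*-zeroʳ c) ⟩
          + 0 * monomial (gap (suc n) 1) 1 j         ≡⟨ ℤP.*-zeroˡ (monomial (gap (suc n) 1) 1 j) ⟩
          + 0                                        ∎
        where c = (+ (2 ℕ.* n) - + (4 ℕ.* 1)) + + 5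
      reassoc : ∀ a b c → a * b * c ≡ b * (a * c)
      reassoc = ℤ-Solver.solve-∀
      coefficient : ∀ M K → ((M + + 2 * K) - + 4 * (+ 1 + K)) + + 5 ≡ M - + 2 * K + + 1
      coefficient = ℤ-Solver.solve-∀
      term : ∀ k → 1 ≤ k → k ≤ n → shiftTerm (suc k) ≡ γ n k * ((+ gap n k - + (2 ℕ.* k) + + 1) * monomial (gap n k) (suc k) j)
      term k _ k≤n = trans (reassoc c (γ n k) _) (cong₂ (λ u e → γ n k * (u * monomial e (suc k) j)) c≡ gap-suc)
        where
        gap-suc : gap (suc n) (suc k) ≡ gap n k
        gap-suc = cong₂ _∸_ (2[1+n] n) (2[1+n] k)
        c = (+ (2 ℕ.* n) - + (4 ℕ.* suc k)) + + 5
        2n≡ : + (2 ℕ.* n) ≡ + gap n k + + 2 * + k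
        2n≡ = trans (cong +_ (sym (gap+2k n k k≤n))) (trans (ℤP.pos-+ (gap n k) (2 ℕ.* k)) (cong (_+_ (+ gap n k)) (ℤP.pos-* 2 k)))
        c≡ : c ≡ + gap n k - + (2 ℕ.* k) + + 1
        c≡ = begin
            (+ (2 ℕ.* n) - + (4 ℕ.* suc k)) + + 5
          ≡⟨ cong₂ (λ u v → (u - v) + + 5) 2n≡ (trans (ℤP.pos-* 4 (suc k)) (cong (_*_ (+ 4)) (ℤP.pos-+ 1 k))) ⟩
            ((+ gap n k + + 2 * + k) - + 4 * (+ 1 + + k)) + + 5
          ≡⟨ coefficient (+ gap n k) (+ k) ⟩
            + gap n k - + 2 * + k + + 1
          ≡⟨ cong (λ z → + gap n k - z + + 1) (ℤP.pos-* 2 k) ⟨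
            + gap n k - + (2 ℕ.* k) + + 1 ∎

    G-step : G (suc n) j ≡ step n (G n) j
    G-step = begin
        G (suc n) j                                          ≡⟨ G-suc-split ⟩
        Σ₁ (suc n) keepTerm + Σ₁ (suc n) shiftTerm           ≡⟨ cong₂ _+_ keep-sum shift-sum ⟩
        keepPart n j + shiftPart n j                         ≡⟨ step-G n j ⟨
        step n (G n) j                                       ∎

  -- The diagonal: γ_{n+2,n+2} = (2(n+1) - 4(n+2) + 5) γ_{n+1,n+1} = -(2n+1) γ_{n+1,n+1},
  -- as γ_{n+1,n+2} = 0; hence γ_{n+1,n+1} = (-1)^n (2n-1)!!.
  γ-diag : ∀ n → γ (suc n) (suc n) ≡ (- (+ 1)) ^ n * + oddDoubleFact n
  γ-diag zero    = refl
  γ-diag (suc n) = begin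
      + suc (suc n) * γ (suc n) (suc (suc n)) + c * γ (suc n) (suc n)
    ≡⟨ cong₂ _+_ (trans (cong (_*_ (+ suc (suc n))) (γ-above (suc n) (suc (suc n)) (ℕP.n<1+n _)))
                        (ℤP.*-zeroʳ (+ suc (suc n))))
                 (cong₂ _*_ c≡ (γ-diag n)) ⟩
      + 0 + (- (+ 1 + + 2 * + n)) * (E * O)
    ≡⟨ regroup (+ n) E O ⟩
      (- (+ 1) * E) * ((+ 1 + + 2 * + n) * O)
    ≡⟨ cong (_*_ (- (+ 1) * E)) odd-suc ⟨
      (- (+ 1)) ^ suc n * + oddDoubleFact (suc n) ∎
    where
    E = (- (+ 1)) ^ n
    O = + oddDoubleFact n
    c = (+ (2 ℕ.* suc n) - + (4 ℕ.* suc (suc n))) + + 5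
    coefficient : ∀ N → (+ 2 * (+ 1 + N) - + 4 * (+ 2 + N)) + + 5 ≡ - (+ 1 + + 2 * N)
    coefficient = ℤ-Solver.solve-∀
    c≡ : c ≡ - (+ 1 + + 2 * + n)
    c≡ = trans (cong₂ (λ u v → (u - v) + + 5) (trans (ℤP.pos-* 2 (suc n)) (cong (_*_ (+ 2)) (ℤP.pos-+ 1 n)))
                                                  (trans (ℤP.pos-* 4 (suc (suc n))) (cong (_*_ (+ 4)) (ℤP.pos-+ 2 n))))
               (coefficient (+ n))
    regroup : ∀ N E O → + 0 + (- (+ 1 + + 2 * N)) * (E * O) ≡ (- (+ 1) * E) * ((+ 1 + + 2 * N) * O)
    regroup = ℤ-Solver.solve-∀
    odd-suc : + oddDoubleFact (suc n) ≡ (+ 1 + + 2 * + n) * O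
    odd-suc = begin
        + ((2 ℕ.* suc n ∸ 1) ℕ.* oddDoubleFact n)   ≡⟨ cong (λ m → + ((m ∸ 1) ℕ.* oddDoubleFact n)) (2[1+n] n) ⟩
        + (suc (2 ℕ.* n) ℕ.* oddDoubleFact n)       ≡⟨ ℤP.pos-* (suc (2 ℕ.* n)) (oddDoubleFact n) ⟩
        + suc (2 ℕ.* n) * O                          ≡⟨ cong (_* O) (trans (ℤP.pos-+ 1 (2 ℕ.* n)) (cong (_+_ (+ 1)) (ℤP.pos-* 2 n))) ⟩
        (+ 1 + + 2 * + n) * O                        ∎

module BooleanTests where

  open import Data.Nat using (zero; suc; _≡ᵇ_; _<ᵇ_; _≤ᵇ_; _≤_; _<_; s≤s)
  import Data.Nat.Properties as ℕP
  open import Data.Bool using (Bool; true; false; _∧_; T)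
  open import Data.Bool.ListAction using (all)
  open import Data.List using ([]; _∷_)
  open import Data.List.Relation.Unary.All using (All; []; _∷_)
  open import Data.Bool.Properties using (T-≡)
  open import Data.Empty using (⊥-elim)
  open import Function.Bundles using (Equivalence)
  open import Relation.Binary.PropositionalEquality

  T⇒≡true : ∀ {b} → T b → b ≡ true
  T⇒≡true = Equivalence.to T-≡

  ≡true⇒T : ∀ {b} → b ≡ true → T b
  ≡true⇒T = Equivalence.from T-≡

  ∧-elimˡ : ∀ {a b} → a ∧ b ≡ true → a ≡ true
  ∧-elimˡ {true} _ = refl

  ∧-elimʳ : ∀ {a b} → a ∧ b ≡ true → b ≡ true
  ∧-elimʳ {true} b≡true = b≡true

  ∧-intro : ∀ {a b} → a ≡ true → b ≡ true → a ∧ b ≡ true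
  ∧-intro refl refl = refl

  ≡ᵇ-refl : ∀ n → (n ≡ᵇ n) ≡ true
  ≡ᵇ-refl zero    = refl
  ≡ᵇ-refl (suc n) = ≡ᵇ-refl n

  ≡ᵇ-sym : ∀ m n → (m ≡ᵇ n) ≡ (n ≡ᵇ m)
  ≡ᵇ-sym zero    zero    = refl
  ≡ᵇ-sym zero    (suc n) = refl
  ≡ᵇ-sym (suc m) zero    = refl
  ≡ᵇ-sym (suc m) (suc n) = ≡ᵇ-sym m n

  ≡ᵇ⇒≡ : ∀ m n → (m ≡ᵇ n) ≡ true → m ≡ n
  ≡ᵇ⇒≡ m n m≡ᵇn = ℕP.≡ᵇ⇒≡ m n (≡true⇒T m≡ᵇn)

  ≡⇒≡ᵇ : ∀ m n → m ≡ n → (m ≡ᵇ n) ≡ true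
  ≡⇒≡ᵇ m .m refl = ≡ᵇ-refl m

  ≢⇒≢ᵇ : ∀ m n → m ≢ n → (m ≡ᵇ n) ≡ false
  ≢⇒≢ᵇ zero    zero    m≢n = ⊥-elim (m≢n refl)
  ≢⇒≢ᵇ zero    (suc n) _   = refl
  ≢⇒≢ᵇ (suc m) zero    _   = refl
  ≢⇒≢ᵇ (suc m) (suc n) m≢n = ≢⇒≢ᵇ m n (λ m≡n → m≢n (cong suc m≡n))

  <⇒≢ᵇ : ∀ a c → a < c → (a ≡ᵇ c) ≡ false
  <⇒≢ᵇ a c a<c = ≢⇒≢ᵇ a c (ℕP.<⇒≢ a<c)

  >⇒≢ᵇ : ∀ a c → a < c → (c ≡ᵇ a) ≡ false
  >⇒≢ᵇ a c a<c = ≢⇒≢ᵇ c a (ℕP.>⇒≢ a<c)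

  <ᵇ⇒< : ∀ m n → (m <ᵇ n) ≡ true → m < n
  <ᵇ⇒< m n m<ᵇn = ℕP.<ᵇ⇒< m n (≡true⇒T m<ᵇn)

  <⇒<ᵇ : ∀ m n → m < n → (m <ᵇ n) ≡ true
  <⇒<ᵇ m n m<n = T⇒≡true (ℕP.<⇒<ᵇ m<n)

  ≤⇒≮ᵇ : ∀ m n → n ≤ m → (m <ᵇ n) ≡ false
  ≤⇒≮ᵇ m       zero    _         = refl
  ≤⇒≮ᵇ (suc m) (suc n) (s≤s n≤m) = ≤⇒≮ᵇ m n n≤m

  ≤ᵇ⇒≤ : ∀ m n → (m ≤ᵇ n) ≡ true → m ≤ n
  ≤ᵇ⇒≤ m n m≤ᵇn = ℕP.≤ᵇ⇒≤ m n (≡true⇒T m≤ᵇn)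

  ≤⇒≤ᵇ : ∀ m n → m ≤ n → (m ≤ᵇ n) ≡ true
  ≤⇒≤ᵇ m n m≤n = T⇒≡true (ℕP.≤⇒≤ᵇ m≤n)

  all-true⁻ : ∀ {A : Set} (f : A → Bool) xs → all f xs ≡ true → All (λ x → f x ≡ true) xs
  all-true⁻ f []       _  = []
  all-true⁻ f (x ∷ xs) fs = ∧-elimˡ fs ∷ all-true⁻ f xs (∧-elimʳ fs)

  all-true⁺ : ∀ {A : Set} (f : A → Bool) xs → All (λ x → f x ≡ true) xs → all f xs ≡ true
  all-true⁺ f []       []       = refl
  all-true⁺ f (x ∷ xs) (p ∷ ps) = ∧-intro p (all-true⁺ f xs ps)

module PairInsertion where

  open BooleanTests
  open import Data.Nat using (ℕ; suc; _+_; _≡ᵇ_; _<ᵇ_; _<_)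
  import Data.Nat.Properties as ℕP
  open import Data.Bool using (true; false; if_then_else_; _∧_; _∨_)
  open import Data.List using (List; []; _∷_; map; _++_)
  open import Data.List.Relation.Unary.All as All using (All; []; _∷_)
  open import Data.List.Relation.Unary.Any using (here; there)
  open import Data.List.Membership.Propositional using (_∈_)
  import Data.List.Membership.Propositional.Properties as ∈P
  open import Data.List.Relation.Unary.Unique.Propositional using (Unique)
  import Data.List.Relation.Unary.Unique.Propositional.Properties as UniqueP
  open import Data.List.Relation.Unary.AllPairs using ([]; _∷_)
  open import Data.Product using (Σ; _×_; _,_)
  open import Data.Empty using (⊥-elim)
  open import Relation.Binary.PropositionalEquality

  -- c differs from every letter of w, in the form produced by the boolean tests.
  Avoids : ℕ → List ℕ → Set
  Avoids c w = All (λ a → (a ≡ᵇ c) ≡ false) w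

  count-++ : ∀ a u v → count a (u ++ v) ≡ count a u + count a v
  count-++ a []      v = refl
  count-++ a (b ∷ u) v with a ≡ᵇ b
  ... | true  = cong suc (count-++ a u v)
  ... | false = count-++ a u v

  count-insert-other : ∀ a c u v → (a ≡ᵇ c) ≡ false → count a (u ++ c ∷ c ∷ v) ≡ count a (u ++ v)
  count-insert-other a c []      v a≢c rewrite a≢c = refl
  count-insert-other a c (b ∷ u) v a≢c with a ≡ᵇ b
  ... | true  = cong suc (count-insert-other a c u v a≢c)
  ... | false = count-insert-other a c u v a≢c

  count-insert-same : ∀ c u v → count c (u ++ c ∷ c ∷ v) ≡ 2 + count c (u ++ v)
  count-insert-same c []      v rewrite ≡ᵇ-refl c = refl
  count-insert-same c (b ∷ u) v with c ≡ᵇ b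
  ... | true  = cong suc (count-insert-same c u v)
  ... | false = count-insert-same c u v

  count-absent⁺ : ∀ a w → All (λ x → (a ≡ᵇ x) ≡ false) w → count a w ≡ 0
  count-absent⁺ a []      []         = refl
  count-absent⁺ a (b ∷ w) (a≢b ∷ ps) rewrite a≢b = count-absent⁺ a w ps

  count-absent⁻ : ∀ a w → count a w ≡ 0 → All (λ x → (a ≡ᵇ x) ≡ false) w
  count-absent⁻ a []      _ = []
  count-absent⁻ a (b ∷ w) count≡0 with a ≡ᵇ b in a≟b
  ... | true  = ⊥-elim (ℕP.1+n≢0 count≡0)
  ... | false = a≟b ∷ count-absent⁻ a w count≡0

  elem-absent : ∀ c w → All (λ x → (c ≡ᵇ x) ≡ false) w → elem c w ≡ false
  elem-absent c []      []         = refl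
  elem-absent c (b ∷ w) (c≢b ∷ ps) rewrite c≢b = elem-absent c w ps

  elem-present : ∀ c w k → count c w ≡ suc k → elem c w ≡ true
  elem-present c (b ∷ w) k count≡ with c ≡ᵇ b
  ... | true  = refl
  ... | false = elem-present c w k count≡

  elem-insert : ∀ a c u v → (a ≡ᵇ c) ≡ false → elem a (u ++ c ∷ c ∷ v) ≡ elem a (u ++ v)
  elem-insert a c []      v a≢c rewrite a≢c = refl
  elem-insert a c (b ∷ u) v a≢c = cong ((a ≡ᵇ b) ∨_) (elem-insert a c u v a≢c)

  beforeLarger-insert : ∀ a c u v → a < c → beforeLarger a (u ++ c ∷ c ∷ v) ≡ beforeLarger a (u ++ v)
  beforeLarger-insert a c []      v a<c rewrite <⇒≢ᵇ a c a<c | <⇒<ᵇ a c a<c = refl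
  beforeLarger-insert a c (b ∷ u) v a<c =
    cong (λ z → if a ≡ᵇ b then true else ((a <ᵇ b) ∧ z)) (beforeLarger-insert a c u v a<c)

  betweenLarger-insert : ∀ c u v → All (_< c) (u ++ v) → betweenLarger (u ++ c ∷ c ∷ v) ≡ betweenLarger (u ++ v)
  betweenLarger-insert c []      v below rewrite ≡ᵇ-refl c | elem-absent c v (All.map (λ {a} → >⇒≢ᵇ a c) below) = refl
  betweenLarger-insert c (a ∷ u) v (a<c ∷ below)
    rewrite elem-insert a c u v (<⇒≢ᵇ a c a<c) | beforeLarger-insert a c u v a<c | betweenLarger-insert c u v below = refl

  betweenLarger-suffix : ∀ u v → betweenLarger (u ++ v) ≡ true → betweenLarger v ≡ true
  betweenLarger-suffix []      v ok = ok
  betweenLarger-suffix (a ∷ u) v ok = betweenLarger-suffix u v (∧-elimʳ ok)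

  insertPair : ℕ → List ℕ → List (List ℕ)
  insertPair c []      = (c ∷ c ∷ []) ∷ []
  insertPair c (a ∷ σ) = (c ∷ c ∷ a ∷ σ) ∷ map (a ∷_) (insertPair c σ)

  insertPair⁻ : ∀ c σ w → w ∈ insertPair c σ → Σ (List ℕ) λ u → Σ (List ℕ) λ v → (σ ≡ u ++ v) × (w ≡ u ++ c ∷ c ∷ v)
  insertPair⁻ c []      w (here refl) = [] , [] , refl , refl
  insertPair⁻ c (a ∷ σ) w (here refl) = [] , a ∷ σ , refl , refl
  insertPair⁻ c (a ∷ σ) w (there w∈) with ∈P.∈-map⁻ (a ∷_) w∈
  ... | w′ , w′∈ , refl with insertPair⁻ c σ w′ w′∈
  ... | u , v , refl , refl = a ∷ u , v , refl , refl

  insertPair⁺ : ∀ c u v → (u ++ c ∷ c ∷ v) ∈ insertPair c (u ++ v)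
  insertPair⁺ c []      []      = here refl
  insertPair⁺ c []      (a ∷ v) = here refl
  insertPair⁺ c (a ∷ u) v       = there (∈P.∈-map⁺ (a ∷_) (insertPair⁺ c u v))

  ∷-injectiveʳ : ∀ {a : ℕ} {x y : List ℕ} → a ∷ x ≡ a ∷ y → x ≡ y
  ∷-injectiveʳ refl = refl

  insertPair-unique : ∀ c σ → Avoids c σ → Unique (insertPair c σ)
  insertPair-unique c []      []         = [] ∷ []
  insertPair-unique c (a ∷ σ) (a≢c ∷ ps) = All.tabulate front≢ ∷ UniqueP.map⁺ ∷-injectiveʳ (insertPair-unique c σ ps)
    where
    front≢ : ∀ {w} → w ∈ map (a ∷_) (insertPair c σ) → (c ∷ c ∷ a ∷ σ) ≢ w
    front≢ w∈ c∷≡ with ∈P.∈-map⁻ _ w∈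
    front≢ w∈ refl | w′ , _ , refl with trans (sym (≡ᵇ-refl c)) a≢c
    ... | ()

  delete : ℕ → List ℕ → List ℕ
  delete c []      = []
  delete c (a ∷ w) = if a ≡ᵇ c then delete c w else a ∷ delete c w

  delete-absent : ∀ c w → Avoids c w → delete c w ≡ w
  delete-absent c []      []         = refl
  delete-absent c (a ∷ w) (a≢c ∷ ps) rewrite a≢c = cong (a ∷_) (delete-absent c w ps)

  delete-insert : ∀ c u v → Avoids c (u ++ v) → delete c (u ++ c ∷ c ∷ v) ≡ u ++ v
  delete-insert c []      v ps rewrite ≡ᵇ-refl c = delete-absent c v ps
  delete-insert c (a ∷ u) v (a≢c ∷ ps) rewrite a≢c = cong (a ∷_) (delete-insert c u v ps)

module StirlingPermutations where

  open BooleanTests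
  open PairInsertion
  open import Data.Nat as ℕ using (ℕ; zero; suc; _≤ᵇ_; _≡ᵇ_; _≤_; _<_; s≤s)
  import Data.Nat.Properties as ℕP
  open import Data.Bool using (true; false; _∧_; T?)
  open import Data.Bool.ListAction using (all)
  open import Data.List using (List; []; _∷_; map; _++_; length; upTo; concatMap)
  import Data.List.Properties as LP
  open import Data.List.Relation.Unary.All as All using (All; []; _∷_)
  open import Data.List.Relation.Unary.Any using (here; there)
  open import Data.List.Membership.Propositional using (_∈_; find; lose)
  import Data.List.Membership.Propositional.Properties as ∈P
  open import Data.List.Relation.Unary.Unique.Propositional using (Unique)
  import Data.List.Relation.Unary.Unique.Propositional.Properties as UniqueP
  open import Data.List.Relation.Unary.AllPairs using ([]; _∷_)
  open import Data.Product using (Σ; _×_; _,_; proj₂)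
  open import Data.Empty using (⊥)
  open import Function using (_∘_)
  open import Relation.Binary.PropositionalEquality

  concatMap-unique : ∀ {A B : Set} (g : A → List B) xs → Unique xs
    → (∀ {x} → x ∈ xs → Unique (g x))
    → (∀ {x y w} → x ∈ xs → y ∈ xs → w ∈ g x → w ∈ g y → x ≡ y)
    → Unique (concatMap g xs)
  concatMap-unique g []       _              _      _        = []
  concatMap-unique g (x ∷ xs) (x∉xs ∷ uxs) unique disjoint =
    UniqueP.++⁺ (unique (here refl))
                (concatMap-unique g xs uxs (unique ∘ there) (λ p q r s → disjoint (there p) (there q) r s))
                apart
    where
    apart : ∀ {w} → w ∈ g x × w ∈ concatMap g xs → ⊥
    apart (w∈gx , w∈rest) with find (∈P.∈-concatMap⁻ g {xs = xs} w∈rest)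
    ... | y , y∈xs , w∈gy = All.lookup x∉xs y∈xs (disjoint (here refl) (there y∈xs) w∈gx w∈gy)

  letters : ℕ → List ℕ
  letters n = map suc (upTo n)

  letters⁻ : ∀ n i → i ∈ letters n → Σ ℕ λ j → (i ≡ suc j) × (j < n)
  letters⁻ n i i∈ with ∈P.∈-map⁻ suc i∈
  ... | j , j∈ , refl = j , refl , ∈P.∈-upTo⁻ j∈

  letters⁺ : ∀ n j → j < n → suc j ∈ letters n
  letters⁺ n j j<n = ∈P.∈-map⁺ suc (∈P.∈-upTo⁺ j<n)

  letters-unique : ∀ n → Unique (letters n)
  letters-unique n = UniqueP.map⁺ ℕP.suc-injective (UniqueP.upTo⁺ n)

  letters-suc : ∀ n → letters (suc n) ≡ letters n ++ (suc n ∷ [])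
  letters-suc n = trans (cong (map suc) (sym (LP.upTo-∷ʳ n))) (LP.map-++ suc (upTo n) (n ∷ []))

  words-unique : ∀ m k → Unique (words m k)
  words-unique m zero    = [] ∷ []
  words-unique m (suc k) =
    concatMap-unique (λ a → map (a ∷_) (words m k)) (letters m) (letters-unique m)
                     (λ _ → UniqueP.map⁺ ∷-injectiveʳ (words-unique m k)) sameHead
    where
    sameHead : ∀ {x y w} → x ∈ letters m → y ∈ letters m → w ∈ map (x ∷_) (words m k) → w ∈ map (y ∷_) (words m k) → x ≡ y
    sameHead _ _ w∈x w∈y with ∈P.∈-map⁻ _ w∈x | ∈P.∈-map⁻ _ w∈y
    ... | _ , _ , refl | _ , _ , refl = refl

  InRange : ℕ → ℕ → Set
  InRange m a = ((1 ≤ᵇ a) ∧ (a ≤ᵇ m)) ≡ true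

  words-complete : ∀ m w → All (InRange m) w → w ∈ words m (length w)
  words-complete m []          []             = here refl
  words-complete m (zero ∷ w)  (() ∷ _)
  words-complete m (suc a ∷ w) (a∈ ∷ w∈) =
    ∈P.∈-concatMap⁺ (λ b → map (b ∷_) (words m (length w)))
                    (lose (letters⁺ m a (<ᵇ⇒< a m a∈)) (∈P.∈-map⁺ (suc a ∷_) (words-complete m w w∈)))

  inRange-≤ : ∀ n a → InRange n a → a ≤ n
  inRange-≤ n a a∈ = ≤ᵇ⇒≤ a n (∧-elimʳ {1 ≤ᵇ a} a∈)

  inRange-< : ∀ n a → InRange n a → a < suc n
  inRange-< n a a∈ = s≤s (inRange-≤ n a a∈)

  inRange-suc : ∀ n a → InRange n a → InRange (suc n) a
  inRange-suc n a a∈ = ∧-intro (∧-elimˡ a∈) (≤⇒≤ᵇ a (suc n) (ℕP.m≤n⇒m≤1+n (inRange-≤ n a a∈)))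

  inRange-top : ∀ n → InRange (suc n) (suc n)
  inRange-top n = ∧-intro refl (≤⇒≤ᵇ (suc n) (suc n) ℕP.≤-refl)

  inRange-pred : ∀ n a → InRange (suc n) a → (suc n ≡ᵇ a) ≡ false → InRange n a
  inRange-pred n a a∈ a≢ = ∧-intro (∧-elimˡ a∈) (≤⇒≤ᵇ a n (ℕP.≤-pred (ℕP.≤∧≢⇒< (inRange-≤ (suc n) a a∈) a≢top)))
    where
    a≢top : a ≢ suc n
    a≢top refl with trans (sym (≡ᵇ-refl (suc n))) a≢
    ... | ()

  record Stirling (n : ℕ) (w : List ℕ) : Set where
    constructor stirling
    field
      length≡ : length w ≡ 2 ℕ.* n
      twice   : All (λ i → count i w ≡ 2) (letters n)
      inRange : All (InRange n) w
      nested  : betweenLarger w ≡ true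

  isStirling⇒Stirling : ∀ n w → isStirling n w ≡ true → Stirling n w
  isStirling⇒Stirling n w ok = stirling
      (≡ᵇ⇒≡ (length w) (2 ℕ.* n) (∧-elimˡ {L} {C ∧ B} multiset))
      (All.map (λ {i} → ≡ᵇ⇒≡ (count i w) 2) (all-true⁻ _ _ (∧-elimˡ {C} {B} counts)))
      (all-true⁻ _ w (∧-elimʳ {C} {B} counts))
      (∧-elimʳ {L ∧ (C ∧ B)} {betweenLarger w} ok)
    where
    L = length w ≡ᵇ 2 ℕ.* n
    C = all (λ i → count i w ≡ᵇ 2) (letters n)
    B = all (λ a → (1 ≤ᵇ a) ∧ (a ≤ᵇ n)) w
    multiset : L ∧ (C ∧ B) ≡ true
    multiset = ∧-elimˡ {L ∧ (C ∧ B)} {betweenLarger w} ok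
    counts : C ∧ B ≡ true
    counts = ∧-elimʳ {L} {C ∧ B} multiset

  Stirling⇒isStirling : ∀ n w → Stirling n w → isStirling n w ≡ true
  Stirling⇒isStirling n w (stirling len tw rng nest) =
    ∧-intro (∧-intro (≡⇒≡ᵇ _ _ len) (∧-intro (all-true⁺ _ _ (All.map (λ {i} → ≡⇒≡ᵇ (count i w) 2) tw)) (all-true⁺ _ w rng))) nest

  Q⁻ : ∀ n w → w ∈ Q n → Stirling n w
  Q⁻ n w w∈ = isStirling⇒Stirling n w (T⇒≡true (proj₂ (∈P.∈-filter⁻ (λ w → T? (isStirling n w)) {xs = words n (2 ℕ.* n)} w∈)))

  Q⁺ : ∀ n w → Stirling n w → w ∈ Q n
  Q⁺ n w st@(stirling len _ rng _) =
    ∈P.∈-filter⁺ (λ w → T? (isStirling n w)) {xs = words n (2 ℕ.* n)}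
                 (subst (λ k → w ∈ words n k) len (words-complete n w rng)) (≡true⇒T (Stirling⇒isStirling n w st))

  Q-unique : ∀ n → Unique (Q n)
  Q-unique n = UniqueP.filter⁺ (λ w → T? (isStirling n w)) {xs = words n (2 ℕ.* n)} (words-unique n (2 ℕ.* n))

-- Q_{n+1} arises from Q_n by inserting (n+1)(n+1) into every gap: the
-- largest letter of a Stirling permutation occurs as an adjacent pair, and
-- removing it leaves a Stirling permutation of order n.
module StirlingRecursion where

  open BooleanTests
  open PairInsertion
  open StirlingPermutations
  open import Data.Nat as ℕ using (ℕ; suc; _≡ᵇ_; _<_; s≤s)
  import Data.Nat.Properties as ℕP
  open import Data.Bool using (true; false; if_then_else_)
  open import Data.List using (List; []; _∷_; _++_; length; concatMap)
  open import Data.List.Relation.Unary.All as All using (All; []; _∷_)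
  import Data.List.Relation.Unary.All.Properties as AllP
  open import Data.List.Membership.Propositional using (_∈_; find; lose)
  import Data.List.Membership.Propositional.Properties as ∈P
  open import Data.List.Membership.Propositional.Properties.WithK using (unique∧set⇒bag)
  open import Data.List.Relation.Binary.BagAndSetEquality using (∼bag⇒↭)
  open import Data.List.Relation.Binary.Permutation.Propositional using (_↭_)
  open import Data.List.Relation.Unary.Unique.Propositional using (Unique)
  open import Data.Product using (Σ; _×_; _,_)
  open import Data.Empty using (⊥-elim)
  open import Function.Bundles using (mk⇔)
  open import Relation.Binary.PropositionalEquality
  import Data.Nat.Tactic.RingSolver as ℕ-Solver

  2[1+n] : ∀ n → 2 ℕ.* suc n ≡ suc (suc (2 ℕ.* n))
  2[1+n] = ℕ-Solver.solve-∀

  length-insert : ∀ (c : ℕ) u v → length (u ++ c ∷ c ∷ v) ≡ suc (suc (length (u ++ v)))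
  length-insert c []      v = refl
  length-insert c (a ∷ u) v = cong suc (length-insert c u v)

  avoids-top : ∀ n σ → Stirling n σ → Avoids (suc n) σ
  avoids-top n σ st = All.map (λ {a} a∈ → <⇒≢ᵇ a (suc n) (inRange-< n a a∈)) (Stirling.inRange st)

  below-top : ∀ n i → i ∈ letters n → (i ≡ᵇ suc n) ≡ false
  below-top n i i∈ with letters⁻ n i i∈
  ... | j , refl , j<n = <⇒≢ᵇ (suc j) (suc n) (s≤s j<n)

  insert-Stirling : ∀ n u v → Stirling n (u ++ v) → Stirling (suc n) (u ++ suc n ∷ suc n ∷ v)
  insert-Stirling n u v (stirling len tw rng nest) = stirling len′ tw′ rng′ nest′
    where
    c = suc n
    len′ : length (u ++ c ∷ c ∷ v) ≡ 2 ℕ.* suc n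
    len′ = trans (length-insert c u v) (trans (cong (λ z → suc (suc z)) len) (sym (2[1+n] n)))
    others : All (λ i → count i (u ++ c ∷ c ∷ v) ≡ 2) (letters n)
    others = All.tabulate (λ {i} i∈ → trans (count-insert-other i c u v (below-top n i i∈)) (All.lookup tw i∈))
    top : count c (u ++ c ∷ c ∷ v) ≡ 2
    top = trans (count-insert-same c u v)
                (cong (2 ℕ.+_) (count-absent⁺ c (u ++ v) (All.map (λ {a} a∈ → >⇒≢ᵇ a c (inRange-< n a a∈)) rng)))
    tw′ : All (λ i → count i (u ++ c ∷ c ∷ v) ≡ 2) (letters (suc n))
    tw′ = subst (All (λ i → count i (u ++ c ∷ c ∷ v) ≡ 2)) (sym (letters-suc n)) (AllP.++⁺ others (top ∷ []))
    rng′ : All (InRange (suc n)) (u ++ c ∷ c ∷ v)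
    rng′ with AllP.++⁻ u rng
    ... | ru , rv = AllP.++⁺ (All.map (λ {a} → inRange-suc n a) ru)
                             (inRange-top n ∷ inRange-top n ∷ All.map (λ {a} → inRange-suc n a) rv)
    nest′ : betweenLarger (u ++ c ∷ c ∷ v) ≡ true
    nest′ = trans (betweenLarger-insert c u v (All.map (λ {a} → inRange-< n a) rng)) nest

  split-first : ∀ c w k → count c w ≡ suc k → Σ (List ℕ) λ u → Σ (List ℕ) λ v → (w ≡ u ++ c ∷ v) × (count c u ≡ 0)
  split-first c (b ∷ w) k count≡ with c ≡ᵇ b in c≟b
  ... | true  = [] , w , cong (_∷ w) (sym (≡ᵇ⇒≡ c b c≟b)) , refl
  ... | false with split-first c w k count≡
  ... | u , v , refl , none = b ∷ u , v , refl , trans (cong (λ t → if t then suc (count c u) else count c u) c≟b) none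

  remove-Stirling : ∀ n u v → Stirling (suc n) (u ++ suc n ∷ suc n ∷ v) → Stirling n (u ++ v)
  remove-Stirling n u v (stirling len tw rng nest) = stirling len′ tw′ rng′ nest′
    where
    c = suc n
    twice′ : All (λ i → count i (u ++ c ∷ c ∷ v) ≡ 2) (letters n ++ (c ∷ []))
    twice′ = subst (All (λ i → count i (u ++ c ∷ c ∷ v) ≡ 2)) (letters-suc n) tw
    absent : All (λ a → (c ≡ᵇ a) ≡ false) (u ++ v)
    absent = count-absent⁻ c (u ++ v) (ℕP.suc-injective (ℕP.suc-injective
               (trans (sym (count-insert-same c u v)) (All.head (AllP.++⁻ʳ (letters n) twice′)))))
    rng′ : All (InRange n) (u ++ v)
    rng′ with AllP.++⁻ u rng
    ... | ru , (_ ∷ _ ∷ rv) = All.zipWith (λ { {a} (a∈ , c≢a) → inRange-pred n a a∈ c≢a }) (AllP.++⁺ ru rv , absent)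
    len′ : length (u ++ v) ≡ 2 ℕ.* n
    len′ = ℕP.suc-injective (ℕP.suc-injective (trans (sym (length-insert c u v)) (trans len (2[1+n] n))))
    tw′ : All (λ i → count i (u ++ v) ≡ 2) (letters n)
    tw′ = All.tabulate (λ {i} i∈ → trans (sym (count-insert-other i c u v (below-top n i i∈)))
                                          (All.lookup (AllP.++⁻ˡ (letters n) twice′) i∈))
    nest′ : betweenLarger (u ++ v) ≡ true
    nest′ = trans (sym (betweenLarger-insert c u v (All.map (λ {a} → inRange-< n a) rng′))) nest

  -- After the first occurrence of the largest letter c comes its second occurrence:
  -- the letters in between would have to exceed c.
  next-is-top : ∀ c b v → beforeLarger c (b ∷ v) ≡ true → b ℕ.≤ c → b ≡ c
  next-is-top c b v ok b≤c with c ≡ᵇ b in c≟b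
  ... | true  = sym (≡ᵇ⇒≡ c b c≟b)
  ... | false = ⊥-elim (ℕP.<⇒≱ (<ᵇ⇒< c b (∧-elimˡ ok)) b≤c)

  count-after-first : ∀ c u v → count c u ≡ 0 → count c (u ++ c ∷ v) ≡ 2 → count c v ≡ 1
  count-after-first c u v none twice with trans (sym (count-++ c u (c ∷ v))) twice
  ... | count≡ rewrite none | ≡ᵇ-refl c = ℕP.suc-injective count≡

  remove-top : ∀ n w → Stirling (suc n) w →
               Σ (List ℕ) λ u → Σ (List ℕ) λ v → (w ≡ u ++ suc n ∷ suc n ∷ v) × Stirling n (u ++ v)
  remove-top n w st = at-first-top (split-first (suc n) w 1 count≡2) count≡2 st
    where
    count≡2 : count (suc n) w ≡ 2
    count≡2 = All.head (AllP.++⁻ʳ (letters n) (subst (All (λ i → count i w ≡ 2)) (letters-suc n) (Stirling.twice st)))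
    at-first-top : ∀ {w} → (Σ (List ℕ) λ u → Σ (List ℕ) λ v → (w ≡ u ++ suc n ∷ v) × (count (suc n) u ≡ 0))
                   → count (suc n) w ≡ 2 → Stirling (suc n) w
                   → Σ (List ℕ) λ u → Σ (List ℕ) λ v → (w ≡ u ++ suc n ∷ suc n ∷ v) × Stirling n (u ++ v)
    at-first-top (u , [] , refl , none) count≡2 st with count-after-first (suc n) u [] none count≡2
    ... | ()
    at-first-top (u , b ∷ v , refl , none) count≡2 st =
      lift (next-is-top (suc n) b v before (inRange-≤ (suc n) b b∈))
      where
      once : count (suc n) (b ∷ v) ≡ 1
      once = count-after-first (suc n) u (b ∷ v) none count≡2
      before : beforeLarger (suc n) (b ∷ v) ≡ true
      before with ∧-elimˡ {if elem (suc n) (b ∷ v) then beforeLarger (suc n) (b ∷ v) else true}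
                          (betweenLarger-suffix u (suc n ∷ b ∷ v) (Stirling.nested st))
      ... | ok rewrite elem-present (suc n) (b ∷ v) 0 once = ok
      b∈ : InRange (suc n) b
      b∈ = All.head (All.tail (AllP.++⁻ʳ u (Stirling.inRange st)))
      lift : b ≡ suc n → Σ (List ℕ) λ u′ → Σ (List ℕ) λ v′ → (u ++ suc n ∷ b ∷ v ≡ u′ ++ suc n ∷ suc n ∷ v′) × Stirling n (u′ ++ v′)
      lift refl = u , v , refl , remove-Stirling n u v st

  Q-suc : ∀ n → Q (suc n) ↭ concatMap (insertPair (suc n)) (Q n)
  Q-suc n = ∼bag⇒↭ (unique∧set⇒bag (Q-unique (suc n)) insertions-unique (λ {w} → mk⇔ (to w) (from w)))
    where
    c = suc n
    avoids : ∀ {σ} → σ ∈ Q n → Avoids c σ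
    avoids {σ} σ∈ = avoids-top n σ (Q⁻ n σ σ∈)
    -- Deleting c recovers σ from any of its insertions, so insertions into different σ differ.
    disjoint : ∀ {x y w} → x ∈ Q n → y ∈ Q n → w ∈ insertPair c x → w ∈ insertPair c y → x ≡ y
    disjoint {x} {y} {w} x∈ y∈ w∈x w∈y with insertPair⁻ c x w w∈x | insertPair⁻ c y w w∈y
    ... | u , v , refl , refl | u′ , v′ , refl , w≡ = begin
        u ++ v                      ≡⟨ delete-insert c u v (avoids x∈) ⟨
        delete c (u ++ c ∷ c ∷ v)    ≡⟨ cong (delete c) w≡ ⟩
        delete c (u′ ++ c ∷ c ∷ v′)  ≡⟨ delete-insert c u′ v′ (avoids y∈) ⟩
        u′ ++ v′                    ∎
      where open ≡-Reasoning
    insertions-unique : Unique (concatMap (insertPair c) (Q n))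
    insertions-unique = concatMap-unique (insertPair c) (Q n) (Q-unique n)
                          (λ {σ} σ∈ → insertPair-unique c σ (avoids σ∈)) disjoint
    to : ∀ w → w ∈ Q (suc n) → w ∈ concatMap (insertPair c) (Q n)
    to w w∈ with remove-top n w (Q⁻ (suc n) w w∈)
    ... | u , v , refl , st = ∈P.∈-concatMap⁺ (insertPair c) (lose (Q⁺ n (u ++ v) st) (insertPair⁺ c u v))
    from : ∀ w → w ∈ concatMap (insertPair c) (Q n) → w ∈ Q (suc n)
    from w w∈ with find (∈P.∈-concatMap⁻ (insertPair c) {xs = Q n} w∈)
    ... | σ , σ∈ , w∈σ with insertPair⁻ c σ w w∈σ
    ... | u , v , refl , refl = Q⁺ (suc n) _ (insert-Stirling n u v (Q⁻ n (u ++ v) σ∈))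

-- If M > M' exceed every letter of
-- π, inserting M M' into π changes its direction word (ascent = true) locally:
-- inserted in front, "down down" is prepended; inserted after a letter
-- followed by direction x, that x becomes "up down down"; inserted at the end,
-- "up down" is appended.  For a direction word d with r blocks (alternating
-- runs) that ends in a descent, the |d|+2 resulting words have r blocks r times,
-- r+1 blocks once, and r+2 blocks in the remaining |d|+1-r cases.
module AlternatingRuns where

  open import Data.Nat using (ℕ; suc; _+_)
  import Data.Nat.Properties as ℕP
  open import Data.Bool using (Bool; true; false; if_then_else_; _xor_)
  open import Data.List using (List; []; _∷_; map; replicate; _++_; length)
  import Data.List.Properties as LP
  open import Data.Product using (Σ; _×_; _,_)
  open import Data.Empty using (⊥)
  open import Relation.Binary.PropositionalEquality
  open import Data.List.Relation.Binary.Permutation.Propositional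
    using (_↭_; ↭-refl; ↭-sym; ↭-trans; ↭-prep; ↭-swap; ↭-reflexive)
  import Data.List.Relation.Binary.Permutation.Propositional.Properties as ↭P

  -- Direction words of the insertions after the first letter, and at any position.
  insertPeak : List Bool → List (List Bool)
  insertPeak []      = (true ∷ false ∷ []) ∷ []
  insertPeak (x ∷ d) = (true ∷ false ∷ false ∷ d) ∷ map (x ∷_) (insertPeak d)

  insertPeakAnywhere : List Bool → List (List Bool)
  insertPeakAnywhere d = (false ∷ false ∷ d) ∷ insertPeak d

  EndsInDescent : List Bool → Set
  EndsInDescent []          = ⊥
  EndsInDescent (x ∷ [])    = x ≡ false
  EndsInDescent (x ∷ y ∷ d) = EndsInDescent (y ∷ d)

  change : Bool → Bool → ℕ
  change x y = if x xor y then 1 else 0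

  doubleDescent : Bool → List Bool → ℕ
  doubleDescent true  d           = 0
  doubleDescent false []          = 0
  doubleDescent false (true ∷ d)  = 0
  doubleDescent false (false ∷ d) = 1

  runsAfter : Bool → List Bool → List ℕ
  runsAfter x d = map (λ e → blocks (x ∷ e)) (insertPeak d)

  spectrum : ℕ → ℕ → ℕ → List ℕ
  spectrum z t R = replicate z R ++ replicate t (2 + R)

  runsAfter-cons : ∀ x y d → runsAfter x (y ∷ d) ≡ blocks (x ∷ true ∷ false ∷ false ∷ d) ∷ map (change x y +_) (runsAfter y d)
  runsAfter-cons x y d = cong (blocks (x ∷ true ∷ false ∷ false ∷ d) ∷_)
                              (trans (sym (LP.map-∘ (insertPeak d))) (LP.map-∘ (insertPeak d)))

  spectrum-shift : ∀ s z t R → map (s +_) (spectrum z t R) ≡ spectrum z t (s + R)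
  spectrum-shift s z t R = trans (LP.map-++ (s +_) (replicate z R) _)
    (cong₂ _++_ (LP.map-replicate (s +_) z R)
                (trans (LP.map-replicate (s +_) t (2 + R)) (cong (replicate t) (trans (ℕP.+-suc s (suc R)) (cong suc (ℕP.+-suc s R))))))

  -- The invariant proved by induction along d: among the |d|+1 insertions after
  -- the first direction x, z keep the number of blocks of x ∷ d and t add two,
  -- where z is determined by the number of blocks of d.
  PrefixRuns : Bool → List Bool → Set
  PrefixRuns x d = Σ ℕ λ z → Σ ℕ λ t → (runsAfter x d ↭ spectrum z t (blocks (x ∷ d)))
                                     × (z + t ≡ suc (length d)) × (z + doubleDescent x d ≡ blocks d)

  prefix-cons : ∀ x y d z t → runsAfter y d ↭ spectrum z t (blocks (y ∷ d))
              → runsAfter x (y ∷ d) ↭ blocks (x ∷ true ∷ false ∷ false ∷ d) ∷ spectrum z t (blocks (x ∷ y ∷ d))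
  prefix-cons x y d z t runs = ↭-trans (↭-reflexive (runsAfter-cons x y d))
    (↭-prep _ (↭-trans (↭P.map⁺ (change x y +_) runs) (↭-reflexive (spectrum-shift (change x y) z t (blocks (y ∷ d))))))

  extend-same : ∀ x y d → blocks (x ∷ true ∷ false ∷ false ∷ d) ≡ blocks (x ∷ y ∷ d)
              → (∀ z → z + doubleDescent y d ≡ blocks d → suc z + doubleDescent x (y ∷ d) ≡ blocks (y ∷ d))
              → PrefixRuns y d → PrefixRuns x (y ∷ d)
  extend-same x y d same count (z , t , runs , len , blocks≡) =
    suc z , t , ↭-trans (prefix-cons x y d z t runs) (↭-reflexive (cong (_∷ spectrum z t (blocks (x ∷ y ∷ d))) same)) ,
    cong suc len , count z blocks≡

  extend-jump : ∀ x y d → blocks (x ∷ true ∷ false ∷ false ∷ d) ≡ 2 + blocks (x ∷ y ∷ d)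
              → (∀ z → z + doubleDescent y d ≡ blocks d → z + doubleDescent x (y ∷ d) ≡ blocks (y ∷ d))
              → PrefixRuns y d → PrefixRuns x (y ∷ d)
  extend-jump x y d jump count (z , t , runs , len , blocks≡) =
    z , suc t ,
    ↭-trans (prefix-cons x y d z t runs)
            (↭-trans (↭-reflexive (cong (_∷ spectrum z t R) jump))
                     (↭-sym (↭P.shift (2 + R) (replicate z R) (replicate t (2 + R))))) ,
    trans (ℕP.+-suc z t) (cong suc len) , count z blocks≡
    where R = blocks (x ∷ y ∷ d)

  prefix-runs : ∀ x d → EndsInDescent d → PrefixRuns x d
  prefix-runs false (false ∷ [])    refl = 0 , 2 , ↭-refl , refl , refl
  prefix-runs true  (false ∷ [])    refl = 1 , 1 , ↭-refl , refl , refl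
  prefix-runs false (false ∷ false ∷ d) ends =
    extend-jump false false (false ∷ d) refl (λ z eq → eq) (prefix-runs false (false ∷ d) ends)
  prefix-runs false (false ∷ true ∷ d)  ends =
    extend-jump false false (true ∷ d) refl (λ z eq → trans (ℕP.+-comm z 1) (cong suc (trans (sym (ℕP.+-identityʳ z)) eq)))
                (prefix-runs false (true ∷ d) ends)
  prefix-runs false (true ∷ false ∷ d)  ends =
    extend-same false true (false ∷ d) refl (λ z eq → cong suc eq) (prefix-runs true (false ∷ d) ends)
  prefix-runs false (true ∷ true ∷ d)   ends =
    extend-jump false true (true ∷ d) refl (λ z eq → eq) (prefix-runs true (true ∷ d) ends)
  prefix-runs true  (false ∷ false ∷ d) ends =
    extend-same true false (false ∷ d) refl (λ z eq → trans (cong suc (ℕP.+-identityʳ z)) (trans (ℕP.+-comm 1 z) eq))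
                (prefix-runs false (false ∷ d) ends)
  prefix-runs true  (false ∷ true ∷ d)  ends =
    extend-same true false (true ∷ d) refl (λ z eq → cong suc eq) (prefix-runs false (true ∷ d) ends)
  prefix-runs true  (true ∷ false ∷ d)  ends =
    extend-same true true (false ∷ d) refl (λ z eq → cong suc eq) (prefix-runs true (false ∷ d) ends)
  prefix-runs true  (true ∷ true ∷ d)   ends =
    extend-jump true true (true ∷ d) refl (λ z eq → eq) (prefix-runs true (true ∷ d) ends)

  AllRuns : List Bool → Set
  AllRuns d = Σ ℕ λ t → (map blocks (insertPeakAnywhere d) ↭ replicate r r ++ suc r ∷ replicate t (2 + r))
                      × (r + t ≡ suc (length d))
    where r = blocks d

  anywhere-runs : ∀ y d z t → runsAfter y d ↭ spectrum z t (blocks (y ∷ d)) →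
                  map blocks (insertPeakAnywhere (y ∷ d))
                    ↭ blocks (false ∷ false ∷ y ∷ d) ∷ blocks (true ∷ false ∷ false ∷ d) ∷ spectrum z t (blocks (y ∷ d))
  anywhere-runs y d z t runs =
    ↭-trans (↭-reflexive (cong (λ rest → blocks (false ∷ false ∷ y ∷ d) ∷ blocks (true ∷ false ∷ false ∷ d) ∷ rest)
                               (sym (LP.map-∘ (insertPeak d)))))
            (↭-prep _ (↭-prep _ runs))

  assemble-same-next : ∀ r z t → r ≡ suc z → r ∷ suc r ∷ spectrum z t r ↭ replicate r r ++ suc r ∷ replicate t (2 + r)
  assemble-same-next .(suc z) z t refl = ↭-prep _ (↭-sym (↭P.shift _ (replicate z (suc z)) _))

  assemble-next-same : ∀ r z t → r ≡ suc z → suc r ∷ r ∷ spectrum z t r ↭ replicate r r ++ suc r ∷ replicate t (2 + r)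
  assemble-next-same r z t r≡ = ↭-trans (↭-swap _ _ ↭-refl) (assemble-same-next r z t r≡)

  assemble-next-jump : ∀ r z t → r ≡ z → suc r ∷ (2 + r) ∷ spectrum z t r ↭ replicate r r ++ suc r ∷ replicate (suc t) (2 + r)
  assemble-next-jump r .r t refl = ↭P.shifts (suc r ∷ (2 + r) ∷ []) (replicate r r)

  descent-blocks : ∀ y d z → z + doubleDescent false (y ∷ d) ≡ blocks (y ∷ d) → blocks (false ∷ y ∷ d) ≡ suc z
  descent-blocks false d z blocks≡ = trans (sym blocks≡) (ℕP.+-comm z 1)
  descent-blocks true  d z blocks≡ = cong suc (trans (sym blocks≡) (ℕP.+-identityʳ z))

  insertion-runs : ∀ d → EndsInDescent d → AllRuns d
  insertion-runs (false ∷ []) refl = 1 , ↭-refl , refl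
  insertion-runs (false ∷ y ∷ d) ends with prefix-runs false (y ∷ d) ends
  ... | z , t , runs , len , blocks≡ =
    t , ↭-trans (anywhere-runs false (y ∷ d) z t runs) (assemble-same-next _ z t r≡) , trans (cong (_+ t) r≡) (cong suc len)
    where
    r≡ : blocks (false ∷ y ∷ d) ≡ suc z
    r≡ = descent-blocks y d z blocks≡
  insertion-runs (true ∷ false ∷ d) ends with prefix-runs true (false ∷ d) ends
  ... | z , t , runs , len , blocks≡ =
    t , ↭-trans (anywhere-runs true (false ∷ d) z t runs) (assemble-next-same _ z t r≡) , trans (cong (_+ t) r≡) (cong suc len)
    where
    r≡ : blocks (true ∷ false ∷ d) ≡ suc z
    r≡ = cong suc (trans (sym blocks≡) (ℕP.+-identityʳ z))
  insertion-runs (true ∷ true ∷ d) ends with prefix-runs true (true ∷ d) ends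
  ... | z , t , runs , len , blocks≡ =
    suc t , ↭-trans (anywhere-runs true (true ∷ d) z t runs) (assemble-next-jump _ z t r≡) ,
    trans (cong (_+ suc t) r≡) (trans (ℕP.+-suc z t) (cong suc len))
    where
    r≡ : blocks (true ∷ true ∷ d) ≡ z
    r≡ = trans (sym blocks≡) (ℕP.+-identityʳ z)

-- Φ turns the insertion of (n+1)(n+1) into a Stirling permutation into the
-- insertion of the peak (2n+2)(2n+1) into its dual, so the alternating runs of
-- all these insertions are described by insertion-runs.
module DualInsertion where

  open BooleanTests
  open PairInsertion
  open StirlingPermutations
  open StirlingRecursion
  open AlternatingRuns

  open import Function using (_∘_)
  open import Data.Nat as ℕ using (ℕ; zero; suc; _+_; _∸_; _≡ᵇ_; _<ᵇ_; _≤_; _<_; s≤s)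
  import Data.Nat.Properties as ℕP
  open import Data.Bool using (Bool; true; false; if_then_else_; _∨_)
  open import Data.List using (List; []; _∷_; map; _++_; length; replicate)
  import Data.List.Properties as LP
  open import Data.List.Relation.Unary.All as All using (All; []; _∷_)
  open import Data.List.Relation.Unary.Any using (here; there)
  open import Data.List.Membership.Propositional using (_∈_; find)
  import Data.List.Membership.Propositional.Properties as ∈P
  open import Data.List.Relation.Binary.Permutation.Propositional using (_↭_; ↭-trans; ↭-reflexive)
  import Data.List.Relation.Binary.Permutation.Propositional.Properties as ↭P
  open import Data.Product using (_,_)
  open import Data.Unit using (⊤)
  open import Relation.Binary.PropositionalEquality

  insertPeakWord : ℕ → ℕ → List ℕ → List (List ℕ)
  insertPeakWord M M' []      = (M ∷ M' ∷ []) ∷ []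
  insertPeakWord M M' (a ∷ π) = (M ∷ M' ∷ a ∷ π) ∷ map (a ∷_) (insertPeakWord M M' π)

  Φgo-cong : ∀ s₁ s₂ w → All (λ a → elem a s₁ ≡ elem a s₂) w → Φgo s₁ w ≡ Φgo s₂ w
  Φgo-cong s₁ s₂ []      []       = refl
  Φgo-cong s₁ s₂ (a ∷ w) (p ∷ ps) =
    cong₂ _∷_ (cong (λ b → if b then 2 ℕ.* a ∸ 1 else 2 ℕ.* a) p)
              (Φgo-cong (a ∷ s₁) (a ∷ s₂) w (All.map (λ {b} q → cong ((b ≡ᵇ a) ∨_) q) ps))

  Φ-insertPair : ∀ c seen σ → elem c seen ≡ false → Avoids c σ
               → map (Φgo seen) (insertPair c σ) ≡ insertPeakWord (2 ℕ.* c) (2 ℕ.* c ∸ 1) (Φgo seen σ)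
  Φ-insertPair c seen []      c∉ [] rewrite c∉ | ≡ᵇ-refl c = refl
  Φ-insertPair c seen (a ∷ σ) c∉ (a≢c ∷ ps) = cong₂ _∷_ front rest
    where
    front : Φgo seen (c ∷ c ∷ a ∷ σ) ≡ 2 ℕ.* c ∷ (2 ℕ.* c ∸ 1) ∷ Φgo seen (a ∷ σ)
    front rewrite c∉ | ≡ᵇ-refl c =
      cong (λ z → 2 ℕ.* c ∷ (2 ℕ.* c ∸ 1) ∷ z)
           (Φgo-cong (c ∷ c ∷ seen) seen (a ∷ σ) (All.map (λ {b} q → cong (λ u → u ∨ (u ∨ elem b seen)) q) (a≢c ∷ ps)))
    c∉′ : elem c (a ∷ seen) ≡ false
    c∉′ rewrite ≡ᵇ-sym c a | a≢c = c∉
    rest : map (Φgo seen) (map (a ∷_) (insertPair c σ))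
           ≡ map ((if elem a seen then 2 ℕ.* a ∸ 1 else 2 ℕ.* a) ∷_) (insertPeakWord (2 ℕ.* c) (2 ℕ.* c ∸ 1) (Φgo (a ∷ seen) σ))
    rest = trans (sym (LP.map-∘ (insertPair c σ)))
                 (trans (LP.map-∘ (insertPair c σ)) (cong (map _) (Φ-insertPair c (a ∷ seen) σ c∉′ ps)))

  module _ (M M' : ℕ) (M'<M : M' < M) where

    directions-insertPeak : ∀ a π → a < M' → All (_< M') π
                          → map (λ v → directions (a ∷ v)) (insertPeakWord M M' π) ≡ insertPeak (directions (a ∷ π))
    directions-insertPeak a [] a<M' []
      rewrite <⇒<ᵇ a M (ℕP.<-trans a<M' M'<M) | ≤⇒≮ᵇ M M' (ℕP.<⇒≤ M'<M) = refl
    directions-insertPeak a (b ∷ π) a<M' (b<M' ∷ π<M') = cong₂ _∷_ front rest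
      where
      front : directions (a ∷ M ∷ M' ∷ b ∷ π) ≡ true ∷ false ∷ false ∷ directions (b ∷ π)
      front rewrite <⇒<ᵇ a M (ℕP.<-trans a<M' M'<M) | ≤⇒≮ᵇ M M' (ℕP.<⇒≤ M'<M) | ≤⇒≮ᵇ M' b (ℕP.<⇒≤ b<M') = refl
      rest : map (λ v → directions (a ∷ v)) (map (b ∷_) (insertPeakWord M M' π)) ≡ map ((a <ᵇ b) ∷_) (insertPeak (directions (b ∷ π)))
      rest = trans (sym (LP.map-∘ (insertPeakWord M M' π)))
                   (trans (LP.map-∘ (insertPeakWord M M' π)) (cong (map ((a <ᵇ b) ∷_)) (directions-insertPeak b π b<M' π<M')))

    directions-insertPeakWord : ∀ a π → a < M' → All (_< M') π
                              → map directions (insertPeakWord M M' (a ∷ π)) ≡ insertPeakAnywhere (directions (a ∷ π))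
    directions-insertPeakWord a π a<M' π<M' =
      cong₂ _∷_ front (trans (sym (LP.map-∘ (insertPeakWord M M' π))) (directions-insertPeak a π a<M' π<M'))
      where
      front : directions (M ∷ M' ∷ a ∷ π) ≡ false ∷ false ∷ directions (a ∷ π)
      front rewrite ≤⇒≮ᵇ M M' (ℕP.<⇒≤ M'<M) | ≤⇒≮ᵇ M' a (ℕP.<⇒≤ a<M') = refl

  Φgo-bound : ∀ n seen w → All (_≤ n) w → All (_≤ 2 ℕ.* n) (Φgo seen w)
  Φgo-bound n seen []      []         = []
  Φgo-bound n seen (a ∷ w) (a≤n ∷ ps) = bound (elem a seen) ∷ Φgo-bound n (a ∷ seen) w ps
    where
    bound : ∀ b → (if b then 2 ℕ.* a ∸ 1 else 2 ℕ.* a) ≤ 2 ℕ.* n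
    bound true  = ℕP.≤-trans (ℕP.m∸n≤m (2 ℕ.* a) 1) (ℕP.*-monoʳ-≤ 2 a≤n)
    bound false = ℕP.*-monoʳ-≤ 2 a≤n

  Φgo-length : ∀ seen w → length (Φgo seen w) ≡ length w
  Φgo-length seen []      = refl
  Φgo-length seen (a ∷ w) = cong suc (Φgo-length (a ∷ seen) w)

  directions-length : ∀ a π → length (directions (a ∷ π)) ≡ length π
  directions-length a []      = refl
  directions-length a (b ∷ π) = cong suc (directions-length b π)

  EmptyOrEndsInDescent : List Bool → Set
  EmptyOrEndsInDescent []      = ⊤
  EmptyOrEndsInDescent (x ∷ d) = EndsInDescent (x ∷ d)

  EndsInDescent-∷ : ∀ x e → EndsInDescent e → EndsInDescent (x ∷ e)
  EndsInDescent-∷ x (y ∷ e) ends = ends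

  insertPeak-ends : ∀ d → EmptyOrEndsInDescent d → ∀ e → e ∈ insertPeak d → EndsInDescent e
  insertPeak-ends []          _    e (here refl) = refl
  insertPeak-ends (x ∷ [])    _    e (here refl) = refl
  insertPeak-ends (x ∷ y ∷ d) ends e (here refl) = ends
  insertPeak-ends (x ∷ d)     ends e (there e∈) with ∈P.∈-map⁻ (x ∷_) e∈
  insertPeak-ends (x ∷ [])    ends e (there e∈) | e′ , e′∈ , refl = EndsInDescent-∷ x e′ (insertPeak-ends [] _ e′ e′∈)
  insertPeak-ends (x ∷ y ∷ d) ends e (there e∈) | e′ , e′∈ , refl = EndsInDescent-∷ x e′ (insertPeak-ends (y ∷ d) ends e′ e′∈)

  insertPeakAnywhere-ends : ∀ d → EndsInDescent d → ∀ e → e ∈ insertPeakAnywhere d → EndsInDescent e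
  insertPeakAnywhere-ends (x ∷ d) ends e (here refl) = ends
  insertPeakAnywhere-ends (x ∷ d) ends e (there e∈) = insertPeak-ends (x ∷ d) ends e e∈

  directions-Φ-insert : ∀ n σ → Stirling (suc n) σ
                      → map directions (map Φ (insertPair (suc (suc n)) σ)) ≡ insertPeakAnywhere (directions (Φ σ))
  directions-Φ-insert n []      (stirling () _ _ _)
  directions-Φ-insert n (s ∷ σ) st =
    trans (cong (map directions) (Φ-insertPair c [] (s ∷ σ) refl (avoids-top (suc n) (s ∷ σ) st)))
          (directions-insertPeakWord M M' M'<M (2 ℕ.* s) (Φgo (s ∷ []) σ)
                                     (below-M' (2 ℕ.* s) (ℕP.*-monoʳ-≤ 2 (All.head letters≤)))
                                     (All.map (λ {v} → below-M' v) (Φgo-bound (suc n) (s ∷ []) σ (All.tail letters≤))))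
    where
    c = suc (suc n)
    M = 2 ℕ.* c
    M' = 2 ℕ.* c ∸ 1
    M'<M : M' < M
    M'<M rewrite 2[1+n] (suc n) = ℕP.n<1+n _
    below-M' : ∀ v → v ≤ 2 ℕ.* suc n → v < M'
    below-M' v v≤ = subst (v <_) (sym (cong (_∸ 1) (2[1+n] (suc n)))) (s≤s v≤)
    letters≤ : All (_≤ suc n) (s ∷ σ)
    letters≤ = All.map (λ {a} → inRange-≤ (suc n) a) (Stirling.inRange st)

  directions-Φ-length : ∀ n σ → Stirling (suc n) σ → suc (length (directions (Φ σ))) ≡ 2 ℕ.* suc n
  directions-Φ-length n []      (stirling () _ _ _)
  directions-Φ-length n (s ∷ σ) st =
    trans (cong suc (trans (directions-length (2 ℕ.* s) (Φgo (s ∷ []) σ)) (Φgo-length (s ∷ []) σ))) (Stirling.length≡ st)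

  -- Every σ ∈ Q_{n+1} has Φ σ ending in a descent: true for n = 0 and preserved by insertions.
  Φ-ends-in-descent : ∀ n σ → σ ∈ Q (suc n) → EndsInDescent (directions (Φ σ))
  Φ-ends-in-descent zero    σ (here refl) = refl
  Φ-ends-in-descent zero    σ (there ())
  Φ-ends-in-descent (suc n) σ σ∈ with find (∈P.∈-concatMap⁻ (insertPair (suc (suc n))) {xs = Q (suc n)} (↭P.∈-resp-↭ (Q-suc (suc n)) σ∈))
  ... | σ′ , σ′∈ , σ∈σ′ =
    insertPeakAnywhere-ends (directions (Φ σ′)) (Φ-ends-in-descent n σ′ σ′∈) (directions (Φ σ))
      (subst (directions (Φ σ) ∈_) (directions-Φ-insert n σ′ (Q⁻ (suc n) σ′ σ′∈)) (∈P.∈-map⁺ directions (∈P.∈-map⁺ Φ σ∈σ′)))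

  runsProfile : ℕ → ℕ → List ℕ
  runsProfile n r = replicate r r ++ suc r ∷ replicate (2 ℕ.* n ∸ r) (2 + r)

  runs-insert : ∀ n σ → σ ∈ Q (suc n)
              → map (altrun ∘ Φ) (insertPair (suc (suc n)) σ) ↭ runsProfile (suc n) (altrun (Φ σ))
  runs-insert n σ σ∈ with insertion-runs (directions (Φ σ)) (Φ-ends-in-descent n σ σ∈)
  ... | t , runs , r+t≡ =
    ↭-trans (↭-reflexive blocks≡) (↭-trans runs (↭-reflexive (cong (λ z → replicate r r ++ suc r ∷ replicate z (2 + r)) t≡)))
    where
    st = Q⁻ (suc n) σ σ∈
    r = altrun (Φ σ)
    L = insertPair (suc (suc n)) σ
    blocks≡ : map (altrun ∘ Φ) L ≡ map blocks (insertPeakAnywhere (directions (Φ σ)))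
    blocks≡ = trans (LP.map-∘ L) (trans (cong (map blocks) (LP.map-∘ L)) (cong (map blocks) (directions-Φ-insert n σ st)))
    t≡ : t ≡ 2 ℕ.* suc n ∸ r
    t≡ = trans (sym (ℕP.m+n∸m≡n r t)) (cong (_∸ r) (trans r+t≡ (directions-Φ-length n σ st)))

module RunDistribution where

  open Coefficients
  open Operator
  open StirlingPermutations
  open StirlingRecursion
  open PairInsertion
  open DualInsertion

  open BooleanTests using (≡ᵇ⇒≡)
  open import Function using (_∘_)
  open import Data.Nat as ℕ using (ℕ; zero; suc; _+_; _∸_; _≡ᵇ_; _≤_; z≤n; s≤s)
  import Data.Nat.Properties as ℕP
  open import Data.Integer as ℤ using (+_)
  import Data.Integer.Properties as ℤP
  open import Data.Bool using (true; false; if_then_else_; T?; _xor_)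
  open import Data.List using (List; []; _∷_; map; _++_; length; concatMap; filter; replicate)
  import Data.List.Properties as LP
  open import Data.List.Relation.Unary.All as All using (All; []; _∷_)
  import Data.List.Relation.Unary.All.Properties as AllP
  open import Data.List.Relation.Unary.Any using (here; there)
  open import Data.List.Membership.Propositional using (_∈_)
  open import Data.List.Relation.Binary.Permutation.Propositional using (_↭_; ↭-refl; ↭-trans; ↭-reflexive)
  import Data.List.Relation.Binary.Permutation.Propositional.Properties as ↭P
  open import Relation.Binary.PropositionalEquality
  open ≡-Reasoning

  occurrences : ℕ → List ℕ → ℕ
  occurrences j xs = length (filter (λ r → T? (r ≡ᵇ j)) xs)

  indicator : ℕ → ℕ → ℕ
  indicator r j = if r ≡ᵇ j then 1 else 0

  occurrences-∷ : ∀ j r xs → occurrences j (r ∷ xs) ≡ indicator r j + occurrences j xs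
  occurrences-∷ j r xs with r ≡ᵇ j
  ... | true  = refl
  ... | false = refl

  occurrences-++ : ∀ j xs ys → occurrences j (xs ++ ys) ≡ occurrences j xs + occurrences j ys
  occurrences-++ j []       ys = refl
  occurrences-++ j (x ∷ xs) ys = begin
      occurrences j (x ∷ xs ++ ys)                       ≡⟨ occurrences-∷ j x (xs ++ ys) ⟩
      indicator x j + occurrences j (xs ++ ys)           ≡⟨ cong (_+_ (indicator x j)) (occurrences-++ j xs ys) ⟩
      indicator x j + (occurrences j xs + occurrences j ys) ≡⟨ ℕP.+-assoc (indicator x j) _ _ ⟨
      (indicator x j + occurrences j xs) + occurrences j ys ≡⟨ cong (_+ occurrences j ys) (occurrences-∷ j x xs) ⟨
      occurrences j (x ∷ xs) + occurrences j ys          ∎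

  occurrences-replicate : ∀ j a v → occurrences j (replicate a v) ≡ a ℕ.* indicator v j
  occurrences-replicate j zero    v = refl
  occurrences-replicate j (suc a) v =
    trans (occurrences-∷ j v (replicate a v)) (cong (_+_ (indicator v j)) (occurrences-replicate j a v))

  occurrences-↭ : ∀ j {xs ys} → xs ↭ ys → occurrences j xs ≡ occurrences j ys
  occurrences-↭ j xs↭ys = ↭P.↭-length (↭P.filter-↭ (λ r → T? (r ≡ᵇ j)) xs↭ys)

  filter-map : ∀ {A : Set} (h : A → ℕ) j (L : List A) → length (filter (λ σ → T? (h σ ≡ᵇ j)) L) ≡ occurrences j (map h L)
  filter-map h j []      = refl
  filter-map h j (x ∷ L) with h x ≡ᵇ j
  ... | true  = cong suc (filter-map h j L)
  ... | false = filter-map h j L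

  concatMap-↭ : ∀ {A B : Set} {f g : A → List B} xs → (∀ x → x ∈ xs → f x ↭ g x) → concatMap f xs ↭ concatMap g xs
  concatMap-↭ []       f↭g = ↭-refl
  concatMap-↭ (x ∷ xs) f↭g = ↭P.++⁺ (f↭g x (here refl)) (concatMap-↭ xs (λ y y∈ → f↭g y (there y∈)))

  runCounts : ℕ → List ℕ
  runCounts n = map (altrun ∘ Φ) (Q n)

  F-occurrences : ∀ n j → F n j ≡ + occurrences j (runCounts n)
  F-occurrences n j = cong +_ (filter-map (altrun ∘ Φ) j (Q n))

  runCounts-suc : ∀ n → runCounts (suc (suc n)) ↭ concatMap (runsProfile (suc n)) (runCounts (suc n))
  runCounts-suc n =
    ↭-trans (↭P.map⁺ (altrun ∘ Φ) (Q-suc (suc n)))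
    (↭-trans (↭-reflexive (LP.map-concatMap (altrun ∘ Φ) (insertPair (suc (suc n))) (Q (suc n))))
    (↭-trans (concatMap-↭ (Q (suc n)) (runs-insert n))
             (↭-reflexive (sym (LP.concatMap-map (runsProfile (suc n)) (altrun ∘ Φ) (Q (suc n)))))))

  indicator-scale : ∀ r k → r ℕ.* indicator r k ≡ k ℕ.* indicator r k
  indicator-scale r k with r ≡ᵇ k in r≟k
  ... | true  rewrite ≡ᵇ⇒≡ r k r≟k = refl
  ... | false = trans (ℕP.*-zeroʳ r) (sym (ℕP.*-zeroʳ k))

  indicator-monus : ∀ m r i → r ≤ m → + ((m ∸ r) ℕ.* indicator r i) ≡ (+ m ℤ.- + i) ℤ.* + indicator r i
  indicator-monus m r i r≤m with r ≡ᵇ i in r≟i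
  ... | true  rewrite ≡ᵇ⇒≡ r i r≟i = begin
      + ((m ∸ i) ℕ.* 1)       ≡⟨ cong +_ (ℕP.*-identityʳ (m ∸ i)) ⟩
      + (m ∸ i)               ≡⟨ ℤP.⊖-≥ r≤m ⟨
      m ℤ.⊖ i                 ≡⟨ ℤP.[+m]-[+n]≡m⊖n m i ⟨
      + m ℤ.- + i             ≡⟨ ℤP.*-identityʳ (+ m ℤ.- + i) ⟨
      (+ m ℤ.- + i) ℤ.* + 1   ∎
  ... | false = trans (cong +_ (ℕP.*-zeroʳ (m ∸ r))) (sym (ℤP.*-zeroʳ (+ m ℤ.- + i)))

  occurrences-runsProfile : ∀ n r j → occurrences j (runsProfile n r)
                            ≡ r ℕ.* indicator r j + (indicator (suc r) j + (2 ℕ.* n ∸ r) ℕ.* indicator (suc (suc r)) j)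
  occurrences-runsProfile n r j =
    trans (occurrences-++ j (replicate r r) _)
          (cong₂ _+_ (occurrences-replicate j r r)
                     (trans (occurrences-∷ j (suc r) _) (cong (_+_ (indicator (suc r) j)) (occurrences-replicate j (2 ℕ.* n ∸ r) (suc (suc r))))))

  -- For a single permutation with r ≤ 2n runs, the run distribution of its
  -- insertions is T_n x^r: this is the combinatorial heart of F_{n+1} = T_n F_n.
  runsProfile-step : ∀ n r j → r ≤ 2 ℕ.* n → + occurrences j (runsProfile n r) ≡ step n (λ i → + indicator r i) j
  runsProfile-step n r zero r≤ =
    cong +_ (trans (occurrences-runsProfile n r 0) (cong₂ _+_ (indicator-scale r 0) (ℕP.*-zeroʳ (2 ℕ.* n ∸ r))))
  runsProfile-step n r (suc zero) r≤ = begin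
      + occurrences 1 (runsProfile n r)
    ≡⟨ cong +_ (occurrences-runsProfile n r 1) ⟩
      + (r ℕ.* indicator r 1 + (indicator r 0 + (2 ℕ.* n ∸ r) ℕ.* 0))
    ≡⟨ cong +_ (cong₂ _+_ (trans (indicator-scale r 1) (ℕP.*-identityˡ (indicator r 1)))
                          (trans (cong (_+_ (indicator r 0)) (ℕP.*-zeroʳ (2 ℕ.* n ∸ r))) (ℕP.+-identityʳ (indicator r 0)))) ⟩
      + (indicator r 1 + indicator r 0)
    ≡⟨ ℤP.pos-+ (indicator r 1) (indicator r 0) ⟩
      step n (λ i → + indicator r i) 1 ∎
  runsProfile-step n r (suc (suc i)) r≤ = begin
      + occurrences (suc (suc i)) (runsProfile n r)
    ≡⟨ cong +_ (occurrences-runsProfile n r (suc (suc i))) ⟩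
      + (r ℕ.* indicator r (suc (suc i)) + (indicator r (suc i) + (2 ℕ.* n ∸ r) ℕ.* indicator r i))
    ≡⟨ trans (ℤP.pos-+ (r ℕ.* indicator r (suc (suc i))) _) (cong (ℤ._+_ (+ (r ℕ.* indicator r (suc (suc i))))) (ℤP.pos-+ (indicator r (suc i)) _)) ⟩
      + (r ℕ.* indicator r (suc (suc i))) ℤ.+ (+ indicator r (suc i) ℤ.+ + ((2 ℕ.* n ∸ r) ℕ.* indicator r i))
    ≡⟨ cong₂ (λ u v → u ℤ.+ (+ indicator r (suc i) ℤ.+ v))
             (trans (cong +_ (indicator-scale r (suc (suc i)))) (ℤP.pos-* (suc (suc i)) (indicator r (suc (suc i)))))
             (indicator-monus (2 ℕ.* n) r i r≤) ⟩
      + suc (suc i) ℤ.* + indicator r (suc (suc i)) ℤ.+ (+ indicator r (suc i) ℤ.+ (+ (2 ℕ.* n) ℤ.- + i) ℤ.* + indicator r i)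
    ≡⟨ ℤP.+-assoc (+ suc (suc i) ℤ.* + indicator r (suc (suc i))) _ _ ⟨
      step n (λ i → + indicator r i) (suc (suc i)) ∎

  concatMap-step : ∀ n V j → All (_≤ 2 ℕ.* n) V →
                   + occurrences j (concatMap (runsProfile n) V) ≡ step n (λ i → + occurrences i V) j
  concatMap-step n []      j []         = sym (step-vanishes n (λ _ → + 0) j (λ _ _ → refl))
  concatMap-step n (r ∷ V) j (r≤ ∷ V≤) = begin
      + occurrences j (runsProfile n r ++ concatMap (runsProfile n) V)
    ≡⟨ trans (cong +_ (occurrences-++ j (runsProfile n r) _)) (ℤP.pos-+ (occurrences j (runsProfile n r)) _) ⟩
      + occurrences j (runsProfile n r) ℤ.+ + occurrences j (concatMap (runsProfile n) V)
    ≡⟨ cong₂ ℤ._+_ (runsProfile-step n r j r≤) (concatMap-step n V j V≤) ⟩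
      step n (λ i → + indicator r i) j ℤ.+ step n (λ i → + occurrences i V) j
    ≡⟨ step-+ n (λ i → + indicator r i) (λ i → + occurrences i V) j ⟨
      step n (λ i → + indicator r i ℤ.+ + occurrences i V) j
    ≡⟨ step-cong n (λ i → trans (sym (ℤP.pos-+ (indicator r i) _)) (cong +_ (sym (occurrences-∷ i r V)))) j ⟩
      step n (λ i → + occurrences i (r ∷ V)) j ∎

  -- A direction word of length ℓ has at most ℓ blocks; so altrun (Φ σ) ≤ 2n.
  blocks-≤-length : ∀ d → blocks d ≤ length d
  blocks-≤-length []           = z≤n
  blocks-≤-length (x ∷ [])     = s≤s z≤n
  blocks-≤-length (x ∷ y ∷ ds) =
    ℕP.≤-trans (ℕP.+-monoˡ-≤ (blocks (y ∷ ds)) (change≤1 (x xor y))) (s≤s (blocks-≤-length (y ∷ ds)))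
    where
    change≤1 : ∀ b → (if b then 1 else 0) ≤ 1
    change≤1 true  = s≤s z≤n
    change≤1 false = z≤n

  runCounts-bound : ∀ n → All (_≤ 2 ℕ.* suc n) (runCounts (suc n))
  runCounts-bound n = AllP.map⁺ (All.tabulate (λ {σ} σ∈ →
    ℕP.≤-trans (blocks-≤-length (directions (Φ σ)))
               (ℕP.≤-trans (ℕP.n≤1+n _) (ℕP.≤-reflexive (directions-Φ-length n σ (Q⁻ (suc n) σ σ∈))))))

  F-step : ∀ n → F (suc (suc n)) ≋ step (suc n) (F (suc n))
  F-step n j = begin
      F (suc (suc n)) j
    ≡⟨ F-occurrences (suc (suc n)) j ⟩
      + occurrences j (runCounts (suc (suc n)))
    ≡⟨ cong +_ (occurrences-↭ j (runCounts-suc n)) ⟩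
      + occurrences j (concatMap (runsProfile (suc n)) (runCounts (suc n)))
    ≡⟨ concatMap-step (suc n) (runCounts (suc n)) j (runCounts-bound n) ⟩
      step (suc n) (λ i → + occurrences i (runCounts (suc n))) j
    ≡⟨ step-cong (suc n) (λ i → sym (F-occurrences (suc n) i)) j ⟩
      step (suc n) (F (suc n)) j ∎

open Coefficients
open Operator
open GammaExpansion
open RunDistribution

open import Data.Nat using (ℕ; zero; suc; _≥_; _∸_; _*_)
open import Data.Integer using (ℤ; -_; +_) renaming (_*_ to _*ℤ_; _^_ to _^ℤ_)
open import Data.Product using (_×_; _,_)
open import Relation.Binary.PropositionalEquality using (_≡_; refl; trans; sym; module ≡-Reasoning)

-- F_n and the γ-expansion agree for n ≥ 1: both are x for n = 1, and both satisfy P_{n+1} = T_n P_n.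
F≋G : ∀ n → F (suc n) ≋ G (suc n)
F≋G zero    zero          = refl
F≋G zero    (suc zero)    = refl
F≋G zero    (suc (suc j)) = refl
F≋G (suc n) j = begin
    F (suc (suc n)) j                ≡⟨ F-step n j ⟩
    step (suc n) (F (suc n)) j       ≡⟨ step-cong (suc n) (F≋G n) j ⟩
    step (suc n) (G (suc n)) j       ≡⟨ Recurrence.G-step n j ⟨
    G (suc (suc n)) j                ∎
  where open ≡-Reasoning

mainTheorem10 : (∀ (n : ℕ) → n ≥ 1 →
                   F n ≋ sumP n (λ k → const (γ n k) ⊛ (X^ k ⊛ (onePlusX ^P (2 * n ∸ 2 * k)))))
                × (∀ (n : ℕ) → n ≥ 1 →
                   γ (suc n) (suc n) ≡ ((- (+ 1)) ^ℤ n) *ℤ (+ oddDoubleFact n))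
mainTheorem10 = expansion , (λ n _ → γ-diag n)
  where
  expansion : ∀ (n : ℕ) → n ≥ 1 → F n ≋ sumP n (λ k → const (γ n k) ⊛ (X^ k ⊛ (onePlusX ^P (2 * n ∸ 2 * k))))
  expansion (suc n) _ j = trans (F≋G n j) (sym (G-coeff (suc n) j))
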